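{- Let $p\geq5$ be a prime, $k$ even, $q=p^k$, $G_q=\mathrm{PSL}(2,q)$, and $\Delta\in\mathbb{F}_q$ a non-square. Let $R_\Delta$ be the image of $\begin{pmatrix}1&\Delta\\0&1\end{pmatrix}$, $\mathcal{D}_\Delta$ its conjugacy class in $G_q$, and $\Gamma_q^-$ the graph on $\mathcal{D}_\Delta$ where distinct $g,h$ are adjacent iff $hg^{ -1}\in\mathcal{D}_\Delta$. Let \[\mathscr{C}_1=\left\{\text{image of }\begin{pmatrix}1&a^2\Delta\\0&1\end{pmatrix} : a\in\mathbb{F}_q\setminus\{0,1,-1\},\ a^2-1\in(\mathbb{F}_q)^2\right\},\] \[\mathscr{C}_2=\left\{\text{image of }\begin{pmatrix}1+4b\Delta^{ -1}&-4b^2\Delta^{ -1}\\4\Delta^{ -1}&1-4b\Delta^{ -1}\end{pmatrix} : b\in\mathbb{F}_q\right\},\] so that the neighbourhood of $R_\Delta$ in $\Gamma_q^-$ is $\mathscr{C}_1\cup\mathscr{C}_2$, and let $\widetilde\Gamma_q^-$ be the subgraph of $\Gamma_q^-$ induced by this neighbourhood. Then $\widetilde\Gamma_q^-$ is the disjoint union (no edges between the parts) of $\Gamma_q^-[\mathscr{C}_1]$ and $\Gamma_q^-[\mathscr{C}_2]$. Moreover, $\Gamma_q^-[\mathscr{C}_2]$ is a disjoint union of $q/p$ cycles of length $p$ when $q\equiv1\pmod4$, and has no edges when $q\equiv3\pmod 4$.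
   Context: $(\mathbb{F}_q)^2$ denotes the set of squares in $\mathbb{F}_q$ (including $0$). -}

module Defs where

open import Level using (Level; _⊔_)
open import Algebra.Bundles using (CommutativeRing)
open import Data.Nat as ℕ using (ℕ; _∸_)
open import Data.Fin using (Fin; toℕ)
open import Data.Product using (Σ; ∃; _×_; _,_; proj₁)
open import Data.Sum using (_⊎_)
open import Relation.Nullary using (¬_)
open import Relation.Binary.PropositionalEquality using (_≡_)
open import Function.Bundles using (_⇔_)

record IsFieldCR {c ℓ : Level} (R : CommutativeRing c ℓ) : Set (c ⊔ ℓ) where
  open CommutativeRing R
  field
    0≉1     : ¬ (0# ≈ 1#)
    inverse : ∀ x → ¬ (x ≈ 0#) → ∃ λ y → x * y ≈ 1#

record HasOrder {c ℓ : Level} (R : CommutativeRing c ℓ) (q : ℕ) : Set (c ⊔ ℓ) where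
  open CommutativeRing R
  field
    enum       : Fin q → Carrier
    enum-inj   : ∀ i j → enum i ≈ enum j → i ≡ j
    enum-surj  : ∀ x → ∃ λ i → enum i ≈ x

module Matrices {c ℓ : Level} (R : CommutativeRing c ℓ) where
  open CommutativeRing R

  IsSquare : Carrier → Set (c ⊔ ℓ)
  IsSquare x = ∃ λ y → y * y ≈ x

  record M₂ : Set c where
    constructor mat
    field
      m11 m12 m21 m22 : Carrier
  open M₂ public

  _·_ : M₂ → M₂ → M₂
  mat a b c' d · mat e f g h = mat (a * e + b * g) (a * f + b * h) (c' * e + d * g) (c' * f + d * h)

  det : M₂ → Carrier
  det (mat a b c' d) = a * d - b * c'

  -- adjugate; equals the inverse for matrices of determinant 1
  adj : M₂ → M₂
  adj (mat a b c' d) = mat d (- b) (- c') a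

  neg : M₂ → M₂
  neg (mat a b c' d) = mat (- a) (- b) (- c') (- d)

  _≈M_ : M₂ → M₂ → Set ℓ
  mat a b c' d ≈M mat e f g h = (a ≈ e) × (b ≈ f) × (c' ≈ g) × (d ≈ h)

  SL₂ : Set (c ⊔ ℓ)
  SL₂ = Σ M₂ λ A → det A ≈ 1#

  -- Equality in PSL(2,F) = SL(2,F)/{±I}: X and Y have the same image.
  _≈P_ : M₂ → M₂ → Set ℓ
  X ≈P Y = X ≈M Y ⊎ X ≈M neg Y

  upper : Carrier → M₂
  upper t = mat 1# t 0# 1#

  -- Conjugacy class 𝒟_Δ of the image of R_Δ = (1 Δ ; 0 1) in PSL(2,F)
  -- (membership for elements of PSL given by SL₂-representatives).
  InD : Carrier → M₂ → Set (c ⊔ ℓ)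
  InD Δ X = ∃ λ (g : SL₂) → ((proj₁ g · upper Δ) · adj (proj₁ g)) ≈P X

  Adj : Carrier → M₂ → M₂ → Set (c ⊔ ℓ)
  Adj Δ g h = ¬ (g ≈P h) × InD Δ (h · adj g)

  InC₁ : Carrier → M₂ → Set (c ⊔ ℓ)
  InC₁ Δ X = ∃ λ a → ¬ (a ≈ 0#) × ¬ (a ≈ 1#) × ¬ (a ≈ - 1#)
                      × IsSquare (a * a - 1#) × (upper (a * a * Δ) ≈P X)

  four : Carrier
  four = 1# + 1# + 1# + 1#

  -- The matrix (1 + 4bΔ⁻¹ , -4b²Δ⁻¹ ; 4Δ⁻¹ , 1 - 4bΔ⁻¹), with δ = Δ⁻¹.
  C₂mat : Carrier → Carrier → M₂
  C₂mat δ b = mat (1# + four * b * δ) (- (four * b * b * δ)) (four * δ) (1# - four * b * δ)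

  InC₂ : Carrier → M₂ → Set (c ⊔ ℓ)
  InC₂ δ X = ∃ λ b → C₂mat δ b ≈P X

  Succ : (n : ℕ) → Fin n → Fin n → Set
  Succ n j j' = (toℕ j' ≡ ℕ.suc (toℕ j)) ⊎ ((toℕ j' ≡ 0) × (ℕ.suc (toℕ j) ≡ n))

  -- The graph with vertex set V (a predicate on matrices, read in PSL) and
  -- adjacency E is a disjoint union of m cycles of length n:
  -- there is a labelling of its vertices by Fin m × Fin n, bijective onto V
  -- (up to equality in PSL), such that two vertices are adjacent iff they are in
  -- the same cycle i and their positions j, j' are consecutive modulo n.
  record CycleUnion {v e : Level} (V : M₂ → Set v) (E : M₂ → M₂ → Set e)
                    (m n : ℕ) : Set (c ⊔ ℓ ⊔ v ⊔ e) where
    field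
      vert   : Fin m → Fin n → M₂
      in-V   : ∀ i j → V (vert i j)
      onto   : ∀ X → V X → ∃ λ i → ∃ λ j → vert i j ≈P X
      inj    : ∀ i j i' j' → vert i j ≈P vert i' j' → (i ≡ i') × (j ≡ j')
      edges  : ∀ i j i' j' →
               E (vert i j) (vert i' j') ⇔
               ((i ≡ i') × (Succ n j j' ⊎ Succ n j' j))

-- Traces separate the two parts of the neighbourhood. Every element of 𝒟_Δ has trace ±2, while for
-- X the image of (1 a²Δ ; 0 1) and Y ∈ 𝒞₂ both X Y⁻¹ and Y X⁻¹ have trace 2 - 4a², which is ±2 only
-- for a ∈ {0, ±1}; the lower left entries (0 against 4Δ⁻¹) show X ≠ Y.
-- Inside 𝒞₂, with C(b) the matrix of parameter b, C(c) C(b)⁻¹ has trace 2 + 16Δ⁻²(c - b)², so C(b)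
-- and C(c) can only be adjacent when (c - b)² = -Δ²/4, that is c = b ± s with s = iΔ/2 for a square
-- root i of -1. Conversely, minus such a product is unipotent with lower left entry -Δγ² for
-- γ = 2Δ⁻¹(1 + i), hence conjugate to R_Δ. So 𝒞₂ is the Cayley graph of (F_q, +) for ±s: the q/p
-- cosets of F_p s, each a p-cycle.
-- Since k is even, q ≡ 1 (mod 4), so the case q ≡ 3 (mod 4) cannot occur, and -1 is a square:
-- Wilson's theorem and the pairing x ↦ Δ/x of the nonzero elements give Δ^((q-1)/2) = -1.
module Submission where

open import Level using (0ℓ)
open import Algebra.Bundles using (CommutativeRing; CommutativeMonoid)
import Algebra.Solver.Ring
open import Algebra.Solver.Ring.AlmostCommutativeRing using (_-Raw-AlmostCommutative⟶_; fromCommutativeRing)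
open import Data.Bool using (if_then_else_)
open import Data.Fin as Fin using (Fin; toℕ)
import Data.Fin.Properties as Fin
open import Data.Fin.Permutation using (Permutation; permutation)
open import Data.Integer as ℤ using (ℤ; +_; -[1+_]; _⊖_)
import Data.Integer.Properties as ℤ
open import Data.List using (List; filter; allFin; length) renaming (lookup to lookupₗ)
open import Data.List.Extrema.Nat using (argmin; f[argmin]≤f[xs])
open import Data.List.Membership.Propositional using (_∈_)
open import Data.List.Membership.Propositional.Properties using (∈-lookup; ∈-filter⁺; ∈-allFin)
open import Data.List.Relation.Unary.All as All using (All)
open import Data.List.Relation.Unary.All.Properties using (all-filter)
import Data.List.Relation.Unary.Any as Any
open import Data.List.Relation.Unary.Any.Properties using (lookup-index)
open import Data.List.Relation.Unary.AllPairs using (_∷_)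
open import Data.List.Relation.Unary.Unique.Propositional using (Unique)
import Data.List.Relation.Unary.Unique.Propositional.Properties as Unique
open import Data.Maybe using (Maybe; just; nothing)
open import Data.Nat as ℕ using (ℕ; zero; suc)
import Data.Nat.Properties as ℕ
open import Data.Nat.Coprimality using (prime⇒coprime; coprime-Bézout)
open import Data.Nat.Divisibility using (divides; m%n≡0⇒n∣m)
open import Data.Nat.DivMod using (_%_; _/_; m≡m%n+[m/n]*n; m%n<n; m<n⇒m%n≡m; n%n≡0; %-distribˡ-*; m∣n⇒o%n%m≡o%m)
open import Data.Nat.GCD using (module Bézout)
open import Data.Nat.Primality using (Prime; prime⇒nonZero; prime⇒irreducible)
open import Data.Nat.Tactic.RingSolver using (solve-∀)
open import Data.Product using (∃; _×_; _,_; proj₁; proj₂)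
open import Data.Sign as Sign using (Sign)
open import Data.Sum as Sum using (_⊎_; inj₁; inj₂; [_,_]′)
open import Data.Empty using (⊥)
open import Data.Unit using (⊤; tt)
open import Function using (_∘_; id; flip)
open import Function.Bundles using (_⇔_; mk⇔; Equivalence)
open import Relation.Binary.Definitions using (tri<; tri≈; tri>)
open import Relation.Binary.PropositionalEquality as ≡ using (_≡_; _≢_)
open import Relation.Nullary using (Dec; yes; no; does; ¬_; contradiction)
open import Relation.Nullary.Decidable using (_×-dec_; _⊎-dec_; ¬?)
open import Relation.Unary using (Pred; Decidable)

open import Defs

-- The ring solver needs coefficients with decidable equality; ℤ maps into every commutative ring.
module IntegerCoefficients {c ℓ} (R : CommutativeRing c ℓ) where
  open CommutativeRing R
  open import Algebra.Properties.Ring ring using (-‿involutive; -0#≈0#; -‿distribˡ-*; -‿distribʳ-*; -‿+-comm)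
  open import Algebra.Properties.Semiring.Mult.TCOptimised semiring using (1+×; ×-homo-+; ×1-homo-*) renaming (_×_ to _×′_)
  open import Relation.Binary.Reasoning.Setoid setoid

  fromℕ : ℕ → Carrier
  fromℕ n = n ×′ 1#

  fromℤ : ℤ → Carrier
  fromℤ (+ n)    = fromℕ n
  fromℤ -[1+ n ] = - fromℕ (suc n)

  private
    signed : Sign → Carrier → Carrier
    signed Sign.+ x = x
    signed Sign.- x = - x

    signed-cong : ∀ s {x y} → x ≈ y → signed s x ≈ signed s y
    signed-cong Sign.+ = λ e → e
    signed-cong Sign.- = -‿cong

    signed-* : ∀ s t x y → signed (s Sign.* t) (x * y) ≈ signed s x * signed t y
    signed-* Sign.+ Sign.+ x y = refl
    signed-* Sign.+ Sign.- x y = -‿distribʳ-* x y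
    signed-* Sign.- Sign.+ x y = -‿distribˡ-* x y
    signed-* Sign.- Sign.- x y = begin
      x * y         ≈⟨ -‿involutive (x * y) ⟨
      - - (x * y)   ≈⟨ -‿cong (-‿distribˡ-* x y) ⟩
      - (- x * y)   ≈⟨ -‿distribʳ-* (- x) y ⟩
      - x * - y     ∎

    fromℤ-◃ : ∀ s n → fromℤ (s ℤ.◃ n) ≈ signed s (fromℕ n)
    fromℤ-◃ Sign.+ zero    = refl
    fromℤ-◃ Sign.- zero    = sym -0#≈0#
    fromℤ-◃ Sign.+ (suc n) = refl
    fromℤ-◃ Sign.- (suc n) = refl

    fromℤ-signed : ∀ i → fromℤ i ≈ signed (ℤ.sign i) (fromℕ ℤ.∣ i ∣)
    fromℤ-signed (+ n)    = refl
    fromℤ-signed -[1+ n ] = refl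

    fromℕ-suc-sub : ∀ m n → fromℕ (suc m) - fromℕ (suc n) ≈ fromℕ m - fromℕ n
    fromℕ-suc-sub m n = begin
      fromℕ (suc m) - fromℕ (suc n)         ≈⟨ +-cong (1+× m 1#) (-‿cong (1+× n 1#)) ⟩
      (1# + fromℕ m) - (1# + fromℕ n)       ≈⟨ +-congˡ (-‿+-comm 1# (fromℕ n)) ⟨
      (1# + fromℕ m) + (- 1# - fromℕ n)     ≈⟨ +-assoc 1# (fromℕ m) _ ⟩
      1# + (fromℕ m + (- 1# - fromℕ n))     ≈⟨ +-congˡ (+-congˡ (+-comm (- 1#) _)) ⟩
      1# + (fromℕ m + (- fromℕ n - 1#))     ≈⟨ +-congˡ (+-assoc (fromℕ m) _ _) ⟨
      1# + ((fromℕ m - fromℕ n) - 1#)       ≈⟨ +-comm 1# _ ⟩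
      ((fromℕ m - fromℕ n) - 1#) + 1#       ≈⟨ +-assoc _ (- 1#) 1# ⟩
      (fromℕ m - fromℕ n) + (- 1# + 1#)     ≈⟨ +-congˡ (-‿inverseˡ 1#) ⟩
      (fromℕ m - fromℕ n) + 0#              ≈⟨ +-identityʳ _ ⟩
      fromℕ m - fromℕ n                     ∎

  fromℤ-⊖ : ∀ m n → fromℤ (m ⊖ n) ≈ fromℕ m - fromℕ n
  fromℤ-⊖ zero    zero    = sym (trans (+-identityˡ _) -0#≈0#)
  fromℤ-⊖ zero    (suc n) = sym (+-identityˡ _)
  fromℤ-⊖ (suc m) zero    = sym (trans (+-congˡ -0#≈0#) (+-identityʳ _))
  fromℤ-⊖ (suc m) (suc n) = begin
    fromℤ (suc m ⊖ suc n)          ≡⟨ ≡.cong fromℤ (ℤ.[1+m]⊖[1+n]≡m⊖n m n) ⟩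
    fromℤ (m ⊖ n)                  ≈⟨ fromℤ-⊖ m n ⟩
    fromℕ m - fromℕ n              ≈⟨ fromℕ-suc-sub m n ⟨
    fromℕ (suc m) - fromℕ (suc n)  ∎

  fromℤ-+ : ∀ i j → fromℤ (i ℤ.+ j) ≈ fromℤ i + fromℤ j
  fromℤ-+ (+ m)    (+ n)    = ×-homo-+ 1# m n
  fromℤ-+ (+ m)    -[1+ n ] = fromℤ-⊖ m (suc n)
  fromℤ-+ -[1+ m ] (+ n)    = trans (fromℤ-⊖ n (suc m)) (+-comm _ _)
  fromℤ-+ -[1+ m ] -[1+ n ] = begin
    - fromℕ (suc (suc (m ℕ.+ n)))    ≡⟨ ≡.cong (λ k → - fromℕ k) (ℕ.+-suc (suc m) n) ⟨
    - fromℕ (suc m ℕ.+ suc n)        ≈⟨ -‿cong (×-homo-+ 1# (suc m) (suc n)) ⟩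
    - (fromℕ (suc m) + fromℕ (suc n)) ≈⟨ -‿+-comm _ _ ⟨
    - fromℕ (suc m) - fromℕ (suc n)  ∎

  fromℤ-* : ∀ i j → fromℤ (i ℤ.* j) ≈ fromℤ i * fromℤ j
  fromℤ-* i j = begin
    fromℤ (s ℤ.◃ ℤ.∣ i ∣ ℕ.* ℤ.∣ j ∣)                  ≈⟨ fromℤ-◃ s (ℤ.∣ i ∣ ℕ.* ℤ.∣ j ∣) ⟩
    signed s (fromℕ (ℤ.∣ i ∣ ℕ.* ℤ.∣ j ∣))             ≈⟨ signed-cong s (×1-homo-* ℤ.∣ i ∣ ℤ.∣ j ∣) ⟩
    signed s (fromℕ ℤ.∣ i ∣ * fromℕ ℤ.∣ j ∣)           ≈⟨ signed-* (ℤ.sign i) (ℤ.sign j) _ _ ⟩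
    signed (ℤ.sign i) (fromℕ ℤ.∣ i ∣) * signed (ℤ.sign j) (fromℕ ℤ.∣ j ∣)
                                                      ≈⟨ *-cong (fromℤ-signed i) (fromℤ-signed j) ⟨
    fromℤ i * fromℤ j                                 ∎
    where s = ℤ.sign i Sign.* ℤ.sign j

  fromℤ-neg : ∀ i → fromℤ (ℤ.- i) ≈ - fromℤ i
  fromℤ-neg (+ zero)  = sym -0#≈0#
  fromℤ-neg ℤ.+[1+ n ] = refl
  fromℤ-neg -[1+ n ]  = sym (-‿involutive _)

  ℤ⟶R : ℤ.+-*-rawRing -Raw-AlmostCommutative⟶ fromCommutativeRing R
  ℤ⟶R = record
    { ⟦_⟧ = fromℤ ; +-homo = fromℤ-+ ; *-homo = fromℤ-* ; -‿homo = fromℤ-neg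
    ; 0-homo = refl ; 1-homo = refl }

  coefficients≟ : ∀ i j → Maybe (fromℤ i ≈ fromℤ j)
  coefficients≟ i j with i ℤ.≟ j
  ... | yes ≡.refl = just refl
  ... | no _       = nothing

  open Algebra.Solver.Ring ℤ.+-*-rawRing (fromCommutativeRing R) ℤ⟶R coefficients≟ public

  0ᵖ 1ᵖ 2ᵖ 4ᵖ : ∀ {n} → Polynomial n
  0ᵖ = con (+ 0)
  1ᵖ = con (+ 1)
  2ᵖ = 1ᵖ :+ 1ᵖ
  4ᵖ = 1ᵖ :+ 1ᵖ :+ 1ᵖ :+ 1ᵖ

count : ∀ {N p} {P : Pred (Fin N) p} → Decidable P → ℕ
count {zero}  P? = 0
count {suc N} P? = (if does (P? Fin.zero) then 1 else 0) ℕ.+ count (P? ∘ Fin.suc)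

module SubsetSum {a ℓ} (M : CommutativeMonoid a ℓ) where
  open CommutativeMonoid M
  open import Algebra.Properties.CommutativeMonoid.Sum M using (sum; ∑-distrib-+; ∑-permute; sum-cong-≋)
  open import Algebra.Properties.Monoid.Mult monoid public using () renaming (_×_ to _×ᴹ_)
  open import Relation.Binary.Reasoning.Setoid setoid

  sumWhere : ∀ {N p} {P : Pred (Fin N) p} → Decidable P → (Fin N → Carrier) → Carrier
  sumWhere P? f = sum (λ i → if does (P? i) then f i else ε)

  sumWhere-cong : ∀ {N p} {P : Pred (Fin N) p} (P? : Decidable P) {f g} →
                  (∀ {i} → P i → f i ≈ g i) → sumWhere P? f ≈ sumWhere P? g
  sumWhere-cong P? {f} {g} f≈g = sum-cong-≋ pointwise
    where
    pointwise : ∀ i → (if does (P? i) then f i else ε) ≈ (if does (P? i) then g i else ε)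
    pointwise i with P? i
    ... | yes Pi = f≈g Pi
    ... | no _   = refl

  sumWhere-∙ : ∀ {N p} {P : Pred (Fin N) p} (P? : Decidable P) f g →
               sumWhere P? f ∙ sumWhere P? g ≈ sumWhere P? (λ i → f i ∙ g i)
  sumWhere-∙ {N} P? f g = trans (sym (∑-distrib-+ {N} _ _)) (sum-cong-≋ pointwise)
    where
    pointwise : ∀ i → (if does (P? i) then f i else ε) ∙ (if does (P? i) then g i else ε)
                      ≈ (if does (P? i) then f i ∙ g i else ε)
    pointwise i with P? i
    ... | yes _ = refl
    ... | no _  = identityˡ ε

  sumWhere-const : ∀ {N p} {P : Pred (Fin N) p} (P? : Decidable P) c → sumWhere P? (λ _ → c) ≈ count P? ×ᴹ c
  sumWhere-const {zero}  P? c = refl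
  sumWhere-const {suc N} P? c with P? Fin.zero
  ... | yes _ = ∙-congˡ (sumWhere-const (P? ∘ Fin.suc) c)
  ... | no _  = trans (identityˡ _) (sumWhere-const (P? ∘ Fin.suc) c)

  sumWhere-empty : ∀ {N p} {P : Pred (Fin N) p} (P? : Decidable P) f → (∀ {i} → ¬ P i) → sumWhere P? f ≈ ε
  sumWhere-empty {zero}  P? f none = refl
  sumWhere-empty {suc N} P? f none with P? Fin.zero
  ... | yes P₀ = contradiction P₀ none
  ... | no _   = trans (identityˡ _) (sumWhere-empty (P? ∘ Fin.suc) (f ∘ Fin.suc) none)

  sumWhere-singleton : ∀ {N p} {P : Pred (Fin N) p} (P? : Decidable P) {i₀} f →
                       (∀ {i} → P i → i ≡ i₀) → P i₀ → sumWhere P? f ≈ f i₀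
  sumWhere-singleton {suc N} P? {Fin.zero} f only P₀ with P? Fin.zero
  ... | no ¬P₀ = contradiction P₀ ¬P₀
  ... | yes _  = trans (∙-congˡ (sumWhere-empty (P? ∘ Fin.suc) (f ∘ Fin.suc) (Fin.0≢1+n ∘ ≡.sym ∘ only))) (identityʳ _)
  sumWhere-singleton {suc N} P? {Fin.suc i₀} f only P₀ with P? Fin.zero
  ... | yes P₀′ = contradiction (only P₀′) Fin.0≢1+n
  ... | no _    = trans (identityˡ _) (sumWhere-singleton (P? ∘ Fin.suc) (f ∘ Fin.suc) (Fin.suc-injective ∘ only) P₀)

  sumWhere-⊎ : ∀ {N p q r} {P : Pred (Fin N) p} {Q : Pred (Fin N) q} {S : Pred (Fin N) r}
               (P? : Decidable P) (Q? : Decidable Q) (S? : Decidable S) →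
               (∀ {i} → P i → Q i ⊎ S i) → (∀ {i} → Q i → P i) → (∀ {i} → S i → P i) →
               (∀ {i} → Q i → ¬ S i) → ∀ f → sumWhere P? f ≈ sumWhere Q? f ∙ sumWhere S? f
  sumWhere-⊎ {N} P? Q? S? split Q⇒P S⇒P disjoint f = trans (sum-cong-≋ pointwise) (∑-distrib-+ {N} _ _)
    where
    pointwise : ∀ i → (if does (P? i) then f i else ε)
                      ≈ (if does (Q? i) then f i else ε) ∙ (if does (S? i) then f i else ε)
    pointwise i with Q? i | S? i | P? i
    ... | yes Qi | yes Si | _      = contradiction Si (disjoint Qi)
    ... | yes _  | no _   | yes _  = sym (identityʳ _)
    ... | yes Qi | no _   | no ¬Pi = contradiction (Q⇒P Qi) ¬Pi
    ... | no _   | yes _  | yes _  = sym (identityˡ _)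
    ... | no _   | yes Si | no ¬Pi = contradiction (S⇒P Si) ¬Pi
    ... | no ¬Qi | no ¬Si | yes Pi = [ (λ Qi → contradiction Qi ¬Qi) , (λ Si → contradiction Si ¬Si) ]′ (split Pi)
    ... | no _   | no _   | no _   = sym (identityˡ ε)

  module Pairing {N p} {P : Pred (Fin N) p} (P? : Decidable P)
                 (τ : Fin N → Fin N) (τ-involutive : ∀ i → τ (τ i) ≡ i)
                 (τ-preserves : ∀ {i} → P i → P (τ i)) (τ-fixpoint-free : ∀ {i} → P i → τ i ≢ i) where

    Lower : Pred (Fin N) p
    Lower i = P i × toℕ i ℕ.< toℕ (τ i)

    lower? : Decidable Lower
    lower? i = P? i ×-dec (toℕ i ℕ.<? toℕ (τ i))

    pairs : ℕ
    pairs = count lower?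

    private
      lower-or-upper : ∀ {i} → P i → Lower i ⊎ Lower (τ i)
      lower-or-upper {i} Pi with ℕ.<-cmp (toℕ i) (toℕ (τ i))
      ... | tri< i<τi _ _ = inj₁ (Pi , i<τi)
      ... | tri≈ _ i≡τi _ = contradiction (≡.sym (Fin.toℕ-injective i≡τi)) (τ-fixpoint-free Pi)
      ... | tri> _ _ τi<i = inj₂ (τ-preserves Pi , ≡.subst (λ j → toℕ (τ i) ℕ.< toℕ j) (≡.sym (τ-involutive i)) τi<i)

      upper⇒P : ∀ {i} → Lower (τ i) → P i
      upper⇒P {i} (Pτi , _) = ≡.subst P (τ-involutive i) (τ-preserves Pτi)

      not-both : ∀ {i} → Lower i → ¬ Lower (τ i)
      not-both {i} (_ , i<τi) (_ , τi<ττi) =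
        ℕ.<-asym i<τi (≡.subst (λ j → toℕ (τ i) ℕ.< toℕ j) (τ-involutive i) τi<ττi)

      τ-permutation : Permutation N N
      τ-permutation = permutation τ τ τ-involutive τ-involutive

    sumWhere-pairs : ∀ f c → (∀ {i} → P i → f i ∙ f (τ i) ≈ c) → sumWhere P? f ≈ pairs ×ᴹ c
    sumWhere-pairs f c paired = begin
      sumWhere P? f                                    ≈⟨ sumWhere-⊎ P? lower? (lower? ∘ τ) lower-or-upper proj₁ upper⇒P not-both f ⟩
      sumWhere lower? f ∙ sumWhere (lower? ∘ τ) f      ≈⟨ ∙-congˡ (∑-permute _ τ-permutation) ⟩
      sumWhere lower? f ∙ sum (λ i → if does (lower? (τ (τ i))) then f (τ i) else ε)
                                                       ≈⟨ ∙-congˡ (sum-cong-≋ λ i → reflexive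
                                                            (≡.cong (λ j → if does (lower? j) then f (τ i) else ε) (τ-involutive i))) ⟩
      sumWhere lower? f ∙ sumWhere lower? (f ∘ τ)      ≈⟨ sumWhere-∙ lower? f (f ∘ τ) ⟩
      sumWhere lower? (λ i → f i ∙ f (τ i))            ≈⟨ sumWhere-cong lower? (paired ∘ proj₁) ⟩
      sumWhere lower? (λ _ → c)                        ≈⟨ sumWhere-const lower? c ⟩
      pairs ×ᴹ c                                       ∎

module FiniteField {c ℓ} (R : CommutativeRing c ℓ) (F : IsFieldCR R) {q : ℕ} (Hq : HasOrder R q) where
  open CommutativeRing R
  open IsFieldCR F
  open HasOrder Hq
  open IntegerCoefficients R
  open import Algebra.Properties.Ring ring
    using (-‿involutive; -0#≈0#; x∙y⁻¹≈ε⇒x≈y; x≈y⇒x∙y⁻¹≈ε; +-cancelˡ)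
  open import Algebra.Properties.Semiring.Mult.TCOptimised semiring using (1+×; ×1-homo-*; ×ᵤ≈×)
  open import Algebra.Properties.Semiring.Exp semiring using (_^_; ^-homo-*)
  open import Relation.Binary.Reasoning.Setoid setoid

  index : Carrier → Fin q
  index x = proj₁ (enum-surj x)

  enum-index : ∀ x → enum (index x) ≈ x
  enum-index x = proj₂ (enum-surj x)

  index-cong : ∀ {x y} → x ≈ y → index x ≡ index y
  index-cong {x} {y} x≈y = enum-inj _ _ (trans (enum-index x) (trans x≈y (sym (enum-index y))))

  index-enum : ∀ i → index (enum i) ≡ i
  index-enum i = enum-inj _ _ (enum-index (enum i))

  index-injective : ∀ {x y} → index x ≡ index y → x ≈ y
  index-injective {x} {y} eq = trans (sym (enum-index x)) (trans (reflexive (≡.cong enum eq)) (enum-index y))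

  infix 4 _≟_
  _≟_ : ∀ x y → Dec (x ≈ y)
  x ≟ y with index x Fin.≟ index y
  ... | yes eq = yes (index-injective eq)
  ... | no neq = no (neq ∘ index-cong)

  lift : (Carrier → Carrier) → Fin q → Fin q
  lift g i = index (g (enum i))

  enum-lift : ∀ g i → enum (lift g i) ≈ g (enum i)
  enum-lift g i = enum-index (g (enum i))

  lift-inverse : ∀ {g h} → (∀ {x y} → x ≈ y → g x ≈ g y) → (∀ x → g (h x) ≈ x) → ∀ i → lift g (lift h i) ≡ i
  lift-inverse {g} {h} g-cong gh i = ≡.trans (index-cong (trans (g-cong (enum-lift h i)) (gh (enum i)))) (index-enum i)

  x*y≈0⇒x≈0∨y≈0 : ∀ {x y} → x * y ≈ 0# → x ≈ 0# ⊎ y ≈ 0#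
  x*y≈0⇒x≈0∨y≈0 {x} {y} xy≈0 with x ≟ 0#
  ... | yes x≈0 = inj₁ x≈0
  ... | no x≉0  = inj₂ (begin
    y                 ≈⟨ *-identityˡ y ⟨
    1# * y            ≈⟨ *-congʳ (trans (*-comm x′ x) x*x′≈1) ⟨
    (x′ * x) * y      ≈⟨ *-assoc x′ x y ⟩
    x′ * (x * y)      ≈⟨ *-congˡ xy≈0 ⟩
    x′ * 0#           ≈⟨ zeroʳ x′ ⟩
    0#                ∎)
    where
    x′ = proj₁ (inverse x x≉0)
    x*x′≈1 = proj₂ (inverse x x≉0)

  *-nonzero : ∀ {x y} → x ≉ 0# → y ≉ 0# → x * y ≉ 0#
  *-nonzero x≉0 y≉0 xy≈0 = [ x≉0 , y≉0 ]′ (x*y≈0⇒x≈0∨y≈0 xy≈0)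

  x*x≈0⇒x≈0 : ∀ {x} → x * x ≈ 0# → x ≈ 0#
  x*x≈0⇒x≈0 xx≈0 = [ id , id ]′ (x*y≈0⇒x≈0∨y≈0 xx≈0)

  x≉0∧x*y≈0⇒y≈0 : ∀ {x y} → x ≉ 0# → x * y ≈ 0# → y ≈ 0#
  x≉0∧x*y≈0⇒y≈0 x≉0 xy≈0 = [ flip contradiction x≉0 , id ]′ (x*y≈0⇒x≈0∨y≈0 xy≈0)

  *-cancelˡ : ∀ {k x y} → k ≉ 0# → k * x ≈ k * y → x ≈ y
  *-cancelˡ {k} {x} {y} k≉0 kx≈ky = x∙y⁻¹≈ε⇒x≈y x y (x≉0∧x*y≈0⇒y≈0 k≉0 k[x-y]≈0)
    where
    k[x-y]≈0 : k * (x - y) ≈ 0#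
    k[x-y]≈0 = trans (solve 3 (λ k x y → k :* (x :- y) := k :* x :- k :* y) refl k x y) (x≈y⇒x∙y⁻¹≈ε kx≈ky)

  x*x≈1⇒x≈±1 : ∀ {x} → x * x ≈ 1# → x ≈ 1# ⊎ x ≈ - 1#
  x*x≈1⇒x≈±1 {x} xx≈1 with x*y≈0⇒x≈0∨y≈0 [x-1][x+1]≈0
    where
    [x-1][x+1]≈0 : (x - 1#) * (x + 1#) ≈ 0#
    [x-1][x+1]≈0 = trans (solve 1 (λ x → (x :- 1ᵖ) :* (x :+ 1ᵖ) := x :* x :- 1ᵖ) refl x)
                         (x≈y⇒x∙y⁻¹≈ε xx≈1)
  ... | inj₁ x-1≈0 = inj₁ (x∙y⁻¹≈ε⇒x≈y x 1# x-1≈0)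
  ... | inj₂ x+1≈0 = inj₂ (x∙y⁻¹≈ε⇒x≈y x (- 1#) (trans (+-congˡ (-‿involutive 1#)) x+1≈0))

  -- A total inverse, with 0 ⁻¹ = 0.
  infix 9 _⁻¹
  _⁻¹ : Carrier → Carrier
  x ⁻¹ with x ≟ 0#
  ... | yes _   = 0#
  ... | no x≉0  = proj₁ (inverse x x≉0)

  ⁻¹-inverseʳ : ∀ {x} → x ≉ 0# → x * x ⁻¹ ≈ 1#
  ⁻¹-inverseʳ {x} x≉0 with x ≟ 0#
  ... | yes x≈0  = contradiction x≈0 x≉0
  ... | no x≉0′  = proj₂ (inverse x x≉0′)

  ⁻¹-zero : ∀ {x} → x ≈ 0# → x ⁻¹ ≈ 0#
  ⁻¹-zero {x} x≈0 with x ≟ 0#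
  ... | yes _    = refl
  ... | no x≉0   = contradiction x≈0 x≉0

  right-inverse-nonzero : ∀ {x y} → x * y ≈ 1# → x ≉ 0#
  right-inverse-nonzero {x} {y} xy≈1 x≈0 = 0≉1 (trans (sym (trans (*-congʳ x≈0) (zeroˡ y))) xy≈1)

  ⁻¹-unique : ∀ {x y} → x * y ≈ 1# → x ⁻¹ ≈ y
  ⁻¹-unique {x} {y} xy≈1 = begin
    x ⁻¹               ≈⟨ *-identityʳ _ ⟨
    x ⁻¹ * 1#          ≈⟨ *-congˡ xy≈1 ⟨
    x ⁻¹ * (x * y)     ≈⟨ solve 3 (λ x′ x y → x′ :* (x :* y) := (x :* x′) :* y) refl (x ⁻¹) x y ⟩
    (x * x ⁻¹) * y     ≈⟨ *-congʳ (⁻¹-inverseʳ (right-inverse-nonzero xy≈1)) ⟩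
    1# * y             ≈⟨ *-identityˡ y ⟩
    y                  ∎

  ⁻¹-nonzero : ∀ {x} → x ≉ 0# → x ⁻¹ ≉ 0#
  ⁻¹-nonzero x≉0 = right-inverse-nonzero (trans (*-comm _ _) (⁻¹-inverseʳ x≉0))

  ⁻¹-cong : ∀ {x y} → x ≈ y → x ⁻¹ ≈ y ⁻¹
  ⁻¹-cong {x} {y} x≈y = by-cases (y ≟ 0#)
    where
    by-cases : Dec (y ≈ 0#) → x ⁻¹ ≈ y ⁻¹
    by-cases (yes y≈0) = trans (⁻¹-zero (trans x≈y y≈0)) (sym (⁻¹-zero y≈0))
    by-cases (no y≉0)  = ⁻¹-unique (trans (*-congʳ x≈y) (⁻¹-inverseʳ y≉0))

  ⁻¹-involutive : ∀ x → x ⁻¹ ⁻¹ ≈ x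
  ⁻¹-involutive x = by-cases (x ≟ 0#)
    where
    by-cases : Dec (x ≈ 0#) → x ⁻¹ ⁻¹ ≈ x
    by-cases (yes x≈0) = trans (⁻¹-zero (⁻¹-zero x≈0)) (sym x≈0)
    by-cases (no x≉0)  = ⁻¹-unique (trans (*-comm _ _) (⁻¹-inverseʳ x≉0))

  ⁻¹-distrib-* : ∀ x y → (x * y) ⁻¹ ≈ x ⁻¹ * y ⁻¹
  ⁻¹-distrib-* x y = by-cases (x ≟ 0#) (y ≟ 0#)
    where
    by-cases : Dec (x ≈ 0#) → Dec (y ≈ 0#) → (x * y) ⁻¹ ≈ x ⁻¹ * y ⁻¹
    by-cases (yes x≈0) _ =
      trans (⁻¹-zero (trans (*-congʳ x≈0) (zeroˡ y))) (sym (trans (*-congʳ (⁻¹-zero x≈0)) (zeroˡ _)))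
    by-cases (no _) (yes y≈0) =
      trans (⁻¹-zero (trans (*-congˡ y≈0) (zeroʳ x))) (sym (trans (*-congˡ (⁻¹-zero y≈0)) (zeroʳ _)))
    by-cases (no x≉0) (no y≉0) = ⁻¹-unique (begin
      (x * y) * (x ⁻¹ * y ⁻¹)    ≈⟨ solve 4 (λ x y x′ y′ → (x :* y) :* (x′ :* y′) := (x :* x′) :* (y :* y′)) refl x y (x ⁻¹) (y ⁻¹) ⟩
      (x * x ⁻¹) * (y * y ⁻¹)    ≈⟨ *-cong (⁻¹-inverseʳ x≉0) (⁻¹-inverseʳ y≉0) ⟩
      1# * 1#                    ≈⟨ *-identityˡ 1# ⟩
      1#                         ∎)

  fromℕ[q]≈0 : fromℕ q ≈ 0#
  fromℕ[q]≈0 = +-cancelˡ S (fromℕ q) 0# (trans (sym S≈S+q) (sym (+-identityʳ S)))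
    where
    open import Algebra.Properties.CommutativeMonoid.Sum +-commutativeMonoid
      using (sum; ∑-permute; ∑-distrib-+; sum-cong-≋; sum-replicate)
    S : Carrier
    S = sum enum
    successor : Permutation q q
    successor = permutation (lift (_+ 1#)) (lift (_- 1#))
      (lift-inverse +-congʳ λ x → solve 1 (λ x → (x :- 1ᵖ) :+ 1ᵖ := x) refl x)
      (lift-inverse +-congʳ λ x → solve 1 (λ x → (x :+ 1ᵖ) :- 1ᵖ := x) refl x)
    S≈S+q : S ≈ S + fromℕ q
    S≈S+q = begin
      S                              ≈⟨ ∑-permute enum successor ⟩
      sum (enum ∘ lift (_+ 1#))      ≈⟨ sum-cong-≋ (enum-lift (_+ 1#)) ⟩
      sum (λ i → enum i + 1#)        ≈⟨ ∑-distrib-+ enum (λ _ → 1#) ⟩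
      S + sum {q} (λ _ → 1#)         ≈⟨ +-congˡ (trans (sum-replicate q) (×ᵤ≈× q 1#)) ⟩
      S + fromℕ q                    ∎

  fromℕ-^ : ∀ m n → fromℕ (m ℕ.^ n) ≈ fromℕ m ^ n
  fromℕ-^ m zero    = refl
  fromℕ-^ m (suc n) = trans (×1-homo-* m (m ℕ.^ n)) (*-congˡ (fromℕ-^ m n))

  x^n≈0⇒x≈0 : ∀ {x} n → x ^ n ≈ 0# → x ≈ 0#
  x^n≈0⇒x≈0 zero    1≈0 = contradiction (sym 1≈0) 0≉1
  x^n≈0⇒x≈0 (suc n) xxⁿ≈0 = [ id , x^n≈0⇒x≈0 n ]′ (x*y≈0⇒x≈0∨y≈0 xxⁿ≈0)

  module PrimeCharacteristic {p k : ℕ} (p-prime : Prime p) (q≡p^k : q ≡ p ℕ.^ k) where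

    fromℕ[p]≈0 : fromℕ p ≈ 0#
    fromℕ[p]≈0 = x^n≈0⇒x≈0 k (trans (sym (fromℕ-^ p k)) (trans (reflexive (≡.cong fromℕ (≡.sym q≡p^k))) fromℕ[q]≈0))

    private
      no-Bézout : ∀ m n a b → fromℕ m ≈ 0# → fromℕ n ≈ 0# → 1 ℕ.+ a ℕ.* m ≡ b ℕ.* n → ⊥
      no-Bézout m n a b m≈0 n≈0 eq = 0≉1 (sym (begin
        1#                         ≈⟨ +-identityʳ 1# ⟨
        1# + 0#                    ≈⟨ +-congˡ (trans (*-congˡ m≈0) (zeroʳ _)) ⟨
        1# + fromℕ a * fromℕ m     ≈⟨ +-congˡ (×1-homo-* a m) ⟨
        1# + fromℕ (a ℕ.* m)       ≈⟨ 1+× (a ℕ.* m) 1# ⟨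
        fromℕ (1 ℕ.+ a ℕ.* m)      ≡⟨ ≡.cong fromℕ eq ⟩
        fromℕ (b ℕ.* n)            ≈⟨ ×1-homo-* b n ⟩
        fromℕ b * fromℕ n          ≈⟨ trans (*-congˡ n≈0) (zeroʳ _) ⟩
        0#                         ∎))

    fromℕ-nonzero : ∀ {n} → 0 ℕ.< n → n ℕ.< p → fromℕ n ≉ 0#
    fromℕ-nonzero {suc n} _ n<p n≈0 with coprime-Bézout (prime⇒coprime p-prime n<p)
    ... | Bézout.+- x y eq = no-Bézout (suc n) p y x n≈0 fromℕ[p]≈0 eq
    ... | Bézout.-+ x y eq = no-Bézout p (suc n) x y fromℕ[p]≈0 n≈0 eq

  private
    module Π  = SubsetSum *-commutativeMonoid
    module Σℕ = SubsetSum ℕ.+-0-commutativeMonoid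

    1^n≈1 : ∀ n → 1# ^ n ≈ 1#
    1^n≈1 zero    = refl
    1^n≈1 (suc n) = trans (*-identityˡ _) (1^n≈1 n)

  Nonzero : Pred (Fin q) ℓ
  Nonzero i = enum i ≉ 0#

  nonzero? : Decidable Nonzero
  nonzero? i = ¬? (enum i ≟ 0#)

  ∏nonzero : Carrier
  ∏nonzero = Π.sumWhere nonzero? enum

  index-unique : ∀ {x i} → enum i ≈ x → i ≡ index x
  index-unique {x} {i} eq = ≡.trans (≡.sym (index-enum i)) (index-cong eq)

  -1≉0 : - 1# ≉ 0#
  -1≉0 -1≈0 = 0≉1 (sym (trans (sym (-‿involutive 1#)) (trans (-‿cong -1≈0) -0#≈0#)))

  x-y≈x⇒y≈0 : ∀ {x y} → x - y ≈ x → y ≈ 0#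
  x-y≈x⇒y≈0 {x} {y} eq = trans (solve 2 (λ x y → y := x :- (x :- y)) refl x y) (x≈y⇒x∙y⁻¹≈ε (sym eq))

  x+y≈x⇒y≈0 : ∀ {x y} → x + y ≈ x → y ≈ 0#
  x+y≈x⇒y≈0 {x} {y} eq = +-cancelˡ x y 0# (trans eq (sym (+-identityʳ x)))

  square≈-1⇒nonzero : ∀ {e} → e * e ≈ - 1# → e ≉ 0#
  square≈-1⇒nonzero {e} e²≈-1 e≈0 = -1≉0 (trans (sym e²≈-1) (trans (*-congʳ e≈0) (zeroˡ e)))

  x⁻¹≈y⇒x≈y : ∀ {x y} → y * y ≈ 1# → x ⁻¹ ≈ y → x ≈ y
  x⁻¹≈y⇒x≈y {x} {y} y²≈1 x⁻¹≈y = trans (sym (⁻¹-involutive x)) (trans (⁻¹-cong x⁻¹≈y) (⁻¹-unique y²≈1))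

  wilson : 1# + 1# ≉ 0# → ∏nonzero ≈ - 1#
  wilson two≉0 = begin
    ∏nonzero                                        ≈⟨ Π.sumWhere-⊎ nonzero? rest? ±1? nonzero⇒rest∨±1 proj₁ ±1-nonzero proj₂ enum ⟩
    Π.sumWhere rest? enum * Π.sumWhere ±1? enum     ≈⟨ *-cong (Inversion.sumWhere-pairs enum 1# inverse-pair)
                                                             (Π.sumWhere-⊎ ±1? one? minus-one? id inj₁ inj₂ 1≉-1 enum) ⟩
    1# ^ Inversion.pairs * (Π.sumWhere one? enum * Π.sumWhere minus-one? enum)
                                                    ≈⟨ *-cong (1^n≈1 Inversion.pairs)
                                                         (*-cong (Π.sumWhere-singleton one? enum index-unique (enum-index 1#))
                                                                 (Π.sumWhere-singleton minus-one? enum index-unique (enum-index (- 1#)))) ⟩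
    1# * (enum (index 1#) * enum (index (- 1#)))    ≈⟨ *-congˡ (*-cong (enum-index 1#) (enum-index (- 1#))) ⟩
    1# * (1# * - 1#)                                ≈⟨ solve 0 (1ᵖ :* (1ᵖ :* :- 1ᵖ) := :- 1ᵖ) refl ⟩
    - 1#                                            ∎
    where
    ±1 Rest : Pred (Fin q) ℓ
    ±1 i = enum i ≈ 1# ⊎ enum i ≈ - 1#
    Rest i = Nonzero i × ¬ ±1 i

    one? : Decidable (λ i → enum i ≈ 1#)
    one? i = enum i ≟ 1#

    minus-one? : Decidable (λ i → enum i ≈ - 1#)
    minus-one? i = enum i ≟ - 1#

    ±1? : Decidable ±1
    ±1? i = one? i ⊎-dec minus-one? i

    rest? : Decidable Rest
    rest? i = nonzero? i ×-dec ¬? (±1? i)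

    1≉-1 : ∀ {i} → enum i ≈ 1# → enum i ≉ - 1#
    1≉-1 x≈1 x≈-1 = two≉0 (trans (+-congˡ (trans (sym x≈1) x≈-1)) (-‿inverseʳ 1#))

    ±1-nonzero : ∀ {i} → ±1 i → Nonzero i
    ±1-nonzero (inj₁ x≈1)  x≈0 = 0≉1 (trans (sym x≈0) x≈1)
    ±1-nonzero (inj₂ x≈-1) x≈0 = -1≉0 (trans (sym x≈-1) x≈0)

    nonzero⇒rest∨±1 : ∀ {i} → Nonzero i → Rest i ⊎ ±1 i
    nonzero⇒rest∨±1 {i} nz with ±1? i
    ... | yes ±1ᵢ = inj₂ ±1ᵢ
    ... | no ¬±1ᵢ = inj₁ (nz , ¬±1ᵢ)

    inverse-preserves : ∀ {i} → Rest i → Rest (lift _⁻¹ i)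
    inverse-preserves {i} (nz , ¬±1) =
      ⁻¹-nonzero nz ∘ trans (sym (enum-lift _⁻¹ i)) ,
      ¬±1 ∘ Sum.map (x⁻¹≈y⇒x≈y (*-identityˡ 1#) ∘ trans (sym (enum-lift _⁻¹ i)))
                    (x⁻¹≈y⇒x≈y (solve 0 (:- 1ᵖ :* :- 1ᵖ := 1ᵖ) refl) ∘ trans (sym (enum-lift _⁻¹ i)))

    inverse-fixpoint-free : ∀ {i} → Rest i → lift _⁻¹ i ≢ i
    inverse-fixpoint-free {i} (nz , ¬±1) τi≡i = ¬±1 (x*x≈1⇒x≈±1 (begin
      enum i * enum i              ≈⟨ *-congˡ (reflexive (≡.cong enum τi≡i)) ⟨
      enum i * enum (lift _⁻¹ i)   ≈⟨ *-congˡ (enum-lift _⁻¹ i) ⟩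
      enum i * enum i ⁻¹           ≈⟨ ⁻¹-inverseʳ nz ⟩
      1#                           ∎))

    inverse-pair : ∀ {i} → Rest i → enum i * enum (lift _⁻¹ i) ≈ 1#
    inverse-pair {i} (nz , _) = trans (*-congˡ (enum-lift _⁻¹ i)) (⁻¹-inverseʳ nz)

    module Inversion = Π.Pairing rest? (lift _⁻¹) (lift-inverse ⁻¹-cong ⁻¹-involutive)
                         inverse-preserves inverse-fixpoint-free

  module _ (Δ : Carrier) (Δ-nonsquare : ¬ ∃ λ y → y * y ≈ Δ) where
    private
      Δ≉0 : Δ ≉ 0#
      Δ≉0 Δ≈0 = Δ-nonsquare (0# , trans (zeroˡ 0#) (sym Δ≈0))

      reflect : Carrier → Carrier
      reflect x = Δ * x ⁻¹

      reflect-cong : ∀ {x y} → x ≈ y → reflect x ≈ reflect y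
      reflect-cong = *-congˡ ∘ ⁻¹-cong

      reflect-involutive : ∀ x → reflect (reflect x) ≈ x
      reflect-involutive x = begin
        Δ * (Δ * x ⁻¹) ⁻¹          ≈⟨ *-congˡ (⁻¹-distrib-* Δ (x ⁻¹)) ⟩
        Δ * (Δ ⁻¹ * x ⁻¹ ⁻¹)       ≈⟨ *-assoc Δ _ _ ⟨
        (Δ * Δ ⁻¹) * x ⁻¹ ⁻¹       ≈⟨ *-cong (⁻¹-inverseʳ Δ≉0) (⁻¹-involutive x) ⟩
        1# * x                     ≈⟨ *-identityˡ x ⟩
        x                          ∎

      reflect-pair : ∀ {i} → Nonzero i → enum i * enum (lift reflect i) ≈ Δ
      reflect-pair {i} nz = begin
        enum i * enum (lift reflect i)    ≈⟨ *-congˡ (enum-lift reflect i) ⟩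
        enum i * (Δ * enum i ⁻¹)          ≈⟨ solve 3 (λ x d x′ → x :* (d :* x′) := d :* (x :* x′)) refl (enum i) Δ (enum i ⁻¹) ⟩
        Δ * (enum i * enum i ⁻¹)          ≈⟨ *-congˡ (⁻¹-inverseʳ nz) ⟩
        Δ * 1#                            ≈⟨ *-identityʳ Δ ⟩
        Δ                                 ∎

      reflect-preserves : ∀ {i} → Nonzero i → Nonzero (lift reflect i)
      reflect-preserves {i} nz τi≈0 = Δ≉0 (begin
        Δ                                 ≈⟨ reflect-pair nz ⟨
        enum i * enum (lift reflect i)    ≈⟨ *-congˡ τi≈0 ⟩
        enum i * 0#                       ≈⟨ zeroʳ _ ⟩
        0#                                ∎)

      reflect-fixpoint-free : ∀ {i} → Nonzero i → lift reflect i ≢ i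
      reflect-fixpoint-free {i} nz τi≡i = Δ-nonsquare (enum i ,
        trans (*-congˡ (reflexive (≡.cong enum (≡.sym τi≡i)))) (reflect-pair nz))

      module ΠReflection = Π.Pairing nonzero? (lift reflect) (lift-inverse reflect-cong reflect-involutive)
                             reflect-preserves reflect-fixpoint-free
      module ℕReflection = Σℕ.Pairing nonzero? (lift reflect) (lift-inverse reflect-cong reflect-involutive)
                             reflect-preserves reflect-fixpoint-free

    private
      halfNonzero : ℕ
      halfNonzero = ΠReflection.pairs

      ∏nonzero≈Δ^half : ∏nonzero ≈ Δ ^ halfNonzero
      ∏nonzero≈Δ^half = ΠReflection.sumWhere-pairs enum Δ reflect-pair

      ones : ∀ {N} → Σℕ.sumWhere {N} (λ _ → yes tt) (λ _ → 1) ≡ N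
      ones {zero}  = ≡.refl
      ones {suc N} = ≡.cong suc (ones {N})

      n×ᴹ2≡2n : ∀ n → n Σℕ.×ᴹ 2 ≡ 2 ℕ.* n
      n×ᴹ2≡2n zero    = ≡.refl
      n×ᴹ2≡2n (suc n) = ≡.trans (≡.cong (2 ℕ.+_) (n×ᴹ2≡2n n)) (≡.sym (ℕ.*-suc 2 n))

      nonzero-or-zero : ∀ {i} → ⊤ → Nonzero i ⊎ enum i ≈ 0#
      nonzero-or-zero {i} _ with enum i ≟ 0#
      ... | yes z = inj₂ z
      ... | no nz = inj₁ nz

      -- q counts 0 and the pairs {x, Δ/x} of nonzero elements.
      q≡1+2half : q ≡ suc (2 ℕ.* halfNonzero)
      q≡1+2half = ≡.trans (≡.sym ones) (≡.trans
        (Σℕ.sumWhere-⊎ (λ _ → yes tt) nonzero? (λ i → enum i ≟ 0#) nonzero-or-zero _ _ (λ nz z → nz z) (λ _ → 1))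
        (≡.trans (≡.cong₂ ℕ._+_ (ℕReflection.sumWhere-pairs (λ _ → 1) 2 (λ _ → ≡.refl))
                                (Σℕ.sumWhere-singleton (λ i → enum i ≟ 0#) (λ _ → 1) index-unique (enum-index 0#)))
                 (≡.trans (ℕ.+-comm _ 1) (≡.cong suc (n×ᴹ2≡2n halfNonzero)))))

      Δ^half≈-1 : 1# + 1# ≉ 0# → Δ ^ halfNonzero ≈ - 1#
      Δ^half≈-1 two≉0 = trans (sym ∏nonzero≈Δ^half) (wilson two≉0)

    √-1 : 1# + 1# ≉ 0# → q % 4 ≡ 1 → ∃ λ i → i * i ≈ - 1#
    √-1 two≉0 q%4≡1 = Δ ^ r , (begin
      Δ ^ r * Δ ^ r      ≈⟨ ^-homo-* Δ r r ⟨
      Δ ^ (r ℕ.+ r)      ≡⟨ ≡.cong (Δ ^_) half≡r+r ⟨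
      Δ ^ halfNonzero    ≈⟨ Δ^half≈-1 two≉0 ⟩
      - 1#               ∎)
      where
      r : ℕ
      r = q / 4
      r*4≡2*[r+r] : ∀ r → r ℕ.* 4 ≡ 2 ℕ.* (r ℕ.+ r)
      r*4≡2*[r+r] = solve-∀
      half≡r+r : halfNonzero ≡ r ℕ.+ r
      half≡r+r = ℕ.*-cancelˡ-≡ halfNonzero (r ℕ.+ r) 2 (≡.trans (ℕ.suc-injective (≡.trans (≡.sym q≡1+2half)
        (≡.trans (m≡m%n+[m/n]*n q 4) (≡.cong (ℕ._+ r ℕ.* 4) q%4≡1)))) (r*4≡2*[r+r] r))

module ProjectiveMatrices {c ℓ} (R : CommutativeRing c ℓ) where
  open CommutativeRing R
  open IntegerCoefficients R
  open Matrices R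
  open import Algebra.Properties.Ring ring using (-‿involutive)
  open import Relation.Binary.Reasoning.Setoid setoid

  -- Solver syntax for the matrix operations of Defs: each operation repeats the defining formula, so the
  -- solver's reading of a term built from them is definitionally the corresponding matrix expression.
  record M₂ᵖ (n : ℕ) : Set where
    constructor matᵖ
    field m11ᵖ m12ᵖ m21ᵖ m22ᵖ : Polynomial n

  module _ {n : ℕ} where
    infixl 7 _·ᵖ_
    _·ᵖ_ : M₂ᵖ n → M₂ᵖ n → M₂ᵖ n
    matᵖ a b c′ d ·ᵖ matᵖ e f g h =
      matᵖ (a :* e :+ b :* g) (a :* f :+ b :* h) (c′ :* e :+ d :* g) (c′ :* f :+ d :* h)

    adjᵖ negᵖ : M₂ᵖ n → M₂ᵖ n
    adjᵖ (matᵖ a b c′ d) = matᵖ d (:- b) (:- c′) a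
    negᵖ (matᵖ a b c′ d) = matᵖ (:- a) (:- b) (:- c′) (:- d)

    trᵖ detᵖ : M₂ᵖ n → Polynomial n
    trᵖ (matᵖ a _ _ d)  = a :+ d
    detᵖ (matᵖ a b c′ d) = a :* d :- b :* c′

    upperᵖ : Polynomial n → M₂ᵖ n
    upperᵖ t = matᵖ 1ᵖ t 0ᵖ 1ᵖ

    C₂ᵖ : Polynomial n → Polynomial n → M₂ᵖ n
    C₂ᵖ δ b = matᵖ (1ᵖ :+ 4ᵖ :* b :* δ) (:- (4ᵖ :* b :* b :* δ)) (4ᵖ :* δ) (1ᵖ :- 4ᵖ :* b :* δ)

  tr : M₂ → Carrier
  tr (mat a _ _ d) = a + d

  ≈M-refl : ∀ {A} → A ≈M A
  ≈M-refl {mat _ _ _ _} = refl , refl , refl , refl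

  ≈M-sym : ∀ {A B} → A ≈M B → B ≈M A
  ≈M-sym {mat _ _ _ _} {mat _ _ _ _} (a , b , c′ , d) = sym a , sym b , sym c′ , sym d

  ≈M-trans : ∀ {A B C} → A ≈M B → B ≈M C → A ≈M C
  ≈M-trans {mat _ _ _ _} {mat _ _ _ _} {mat _ _ _ _} (a , b , c′ , d) (a′ , b′ , c″ , d′) =
    trans a a′ , trans b b′ , trans c′ c″ , trans d d′

  neg-cong : ∀ {A B} → A ≈M B → neg A ≈M neg B
  neg-cong {mat _ _ _ _} {mat _ _ _ _} (a , b , c′ , d) = -‿cong a , -‿cong b , -‿cong c′ , -‿cong d

  neg-involutive : ∀ A → neg (neg A) ≈M A
  neg-involutive (mat a b c′ d) = -‿involutive a , -‿involutive b , -‿involutive c′ , -‿involutive d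

  ≈P-refl : ∀ {A} → A ≈P A
  ≈P-refl = inj₁ ≈M-refl

  ≈P-sym : ∀ {A B} → A ≈P B → B ≈P A
  ≈P-sym     (inj₁ A≈B)  = inj₁ (≈M-sym A≈B)
  ≈P-sym {B = B} (inj₂ A≈-B) = inj₂ (≈M-trans (≈M-sym (neg-involutive B)) (neg-cong (≈M-sym A≈-B)))

  ≈P-trans : ∀ {A B C} → A ≈P B → B ≈P C → A ≈P C
  ≈P-trans (inj₁ A≈B)  (inj₁ B≈C)  = inj₁ (≈M-trans A≈B B≈C)
  ≈P-trans (inj₁ A≈B)  (inj₂ B≈-C) = inj₂ (≈M-trans A≈B B≈-C)
  ≈P-trans (inj₂ A≈-B) (inj₁ B≈C)  = inj₂ (≈M-trans A≈-B (neg-cong B≈C))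
  ≈P-trans {C = C} (inj₂ A≈-B) (inj₂ B≈-C) = inj₁ (≈M-trans A≈-B (≈M-trans (neg-cong B≈-C) (neg-involutive C)))

  infix 4 _≈±_
  _≈±_ : Carrier → Carrier → Set ℓ
  x ≈± y = x ≈ y ⊎ x ≈ - y

  ≈±-sym : ∀ {x y} → x ≈± y → y ≈± x
  ≈±-sym (inj₁ x≈y)  = inj₁ (sym x≈y)
  ≈±-sym (inj₂ x≈-y) = inj₂ (trans (sym (-‿involutive _)) (-‿cong (sym x≈-y)))

  ≈±-trans : ∀ {x y z} → x ≈± y → y ≈± z → x ≈± z
  ≈±-trans (inj₁ x≈y)  (inj₁ y≈z)  = inj₁ (trans x≈y y≈z)
  ≈±-trans (inj₁ x≈y)  (inj₂ y≈-z) = inj₂ (trans x≈y y≈-z)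
  ≈±-trans (inj₂ x≈-y) (inj₁ y≈z)  = inj₂ (trans x≈-y (-‿cong y≈z))
  ≈±-trans (inj₂ x≈-y) (inj₂ y≈-z) = inj₁ (trans x≈-y (trans (-‿cong y≈-z) (-‿involutive _)))

  ±0 : ∀ {x} → x ≈± 0# → x ≈ 0#
  ±0 (inj₁ x≈0)  = x≈0
  ±0 (inj₂ x≈-0) = trans x≈-0 (solve 0 (:- 0ᵖ := 0ᵖ) refl)

  InD-resp-≈P : ∀ {Δ X Y} → InD Δ X → X ≈P Y → InD Δ Y
  InD-resp-≈P (g , conj≈X) X≈Y = g , ≈P-trans conj≈X X≈Y

  m21-≈P : ∀ {A B} → A ≈P B → m21 A ≈± m21 B
  m21-≈P {mat _ _ _ _} {mat _ _ _ _} (inj₁ (_ , _ , e , _)) = inj₁ e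
  m21-≈P {mat _ _ _ _} {mat _ _ _ _} (inj₂ (_ , _ , e , _)) = inj₂ e

  tr-≈P : ∀ {A B} → A ≈P B → tr A ≈± tr B
  tr-≈P {mat _ _ _ _} {mat _ _ _ _} (inj₁ (a , _ , _ , d)) = inj₁ (+-cong a d)
  tr-≈P {mat _ _ _ _} {mat _ _ _ _} (inj₂ (a , _ , _ , d)) = inj₂ (trans (+-cong a d) (solve 2 (λ a d → :- a :+ :- d := :- (a :+ d)) refl _ _))

  tr-·adj-≈P : ∀ {Y Y′ X X′} → Y ≈P Y′ → X ≈P X′ → tr (Y · adj X) ≈± tr (Y′ · adj X′)
  tr-·adj-≈P {Y} {Y′} {X} {X′} Y≈Y′ X≈X′ = ≈±-trans (left Y≈Y′) (right X≈X′)
    where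
    T-cong : ∀ {Y Y′ X X′} → Y ≈M Y′ → X ≈M X′ → tr (Y · adj X) ≈ tr (Y′ · adj X′)
    T-cong {mat _ _ _ _} {mat _ _ _ _} {mat _ _ _ _} {mat _ _ _ _} (a , b , c′ , d) (e , f , g , h) =
      +-cong (+-cong (*-cong a h) (*-cong b (-‿cong g))) (+-cong (*-cong c′ (-‿cong f)) (*-cong d e))
    T-negˡ : ∀ Y X → tr (neg Y · adj X) ≈ - tr (Y · adj X)
    T-negˡ (mat a b c′ d) (mat e f g h) = solve 8 (λ a b c′ d e f g h →
      trᵖ (negᵖ (matᵖ a b c′ d) ·ᵖ adjᵖ (matᵖ e f g h)) := :- trᵖ (matᵖ a b c′ d ·ᵖ adjᵖ (matᵖ e f g h))) refl a b c′ d e f g h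
    T-negʳ : ∀ Y X → tr (Y · adj (neg X)) ≈ - tr (Y · adj X)
    T-negʳ (mat a b c′ d) (mat e f g h) = solve 8 (λ a b c′ d e f g h →
      trᵖ (matᵖ a b c′ d ·ᵖ adjᵖ (negᵖ (matᵖ e f g h))) := :- trᵖ (matᵖ a b c′ d ·ᵖ adjᵖ (matᵖ e f g h))) refl a b c′ d e f g h
    left : Y ≈P Y′ → tr (Y · adj X) ≈± tr (Y′ · adj X)
    left (inj₁ e) = inj₁ (T-cong e ≈M-refl)
    left (inj₂ e) = inj₂ (trans (T-cong e ≈M-refl) (T-negˡ Y′ X))
    right : X ≈P X′ → tr (Y′ · adj X) ≈± tr (Y′ · adj X′)
    right (inj₁ e) = inj₁ (T-cong ≈M-refl e)
    right (inj₂ e) = inj₂ (trans (T-cong ≈M-refl e) (T-negʳ Y′ X′))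

  open M₂ᵖ

  conjugate-upper : ∀ a b c′ d t → let g = mat a b c′ d in
    ((g · upper t) · adj g) ≈M mat (det g - t * a * c′) (t * a * a) (- (t * c′ * c′)) (det g + t * a * c′)
  conjugate-upper a b c′ d t =
      solve 5 (λ a b c′ d t → m11ᵖ (conj a b c′ d t) := detᵖ (matᵖ a b c′ d) :- t :* a :* c′) refl a b c′ d t
    , solve 5 (λ a b c′ d t → m12ᵖ (conj a b c′ d t) := t :* a :* a) refl a b c′ d t
    , solve 5 (λ a b c′ d t → m21ᵖ (conj a b c′ d t) := :- (t :* c′ :* c′)) refl a b c′ d t
    , solve 5 (λ a b c′ d t → m22ᵖ (conj a b c′ d t) := detᵖ (matᵖ a b c′ d) :+ t :* a :* c′) refl a b c′ d t
    where
    conj : ∀ {n} → (a b c′ d t : Polynomial n) → M₂ᵖ n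
    conj a b c′ d t = (matᵖ a b c′ d ·ᵖ upperᵖ t) ·ᵖ adjᵖ (matᵖ a b c′ d)

  InD⇒tr≈±2 : ∀ {Δ Z} → InD Δ Z → tr Z ≈± 1# + 1#
  InD⇒tr≈±2 {Δ} {Z} ((mat a b c′ d , det≈1) , conj≈Z) = ≈±-trans (≈±-sym (tr-≈P conj≈Z)) (inj₁ (begin
    tr ((g · upper Δ) · adj g)            ≈⟨ +-cong (proj₁ conj) (proj₂ (proj₂ (proj₂ conj))) ⟩
    (det g - Δ * a * c′) + (det g + Δ * a * c′)
                                          ≈⟨ solve 2 (λ D x → (D :- x) :+ (D :+ x) := 2ᵖ :* D) refl (det g) (Δ * a * c′) ⟩
    (1# + 1#) * det g                     ≈⟨ *-congˡ det≈1 ⟩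
    (1# + 1#) * 1#                        ≈⟨ *-identityʳ _ ⟩
    1# + 1#                               ∎))
    where
    g = mat a b c′ d
    conj = conjugate-upper a b c′ d Δ

  det-·adj : ∀ X Y → det (X · adj Y) ≈ det X * det Y
  det-·adj (mat a b c′ d) (mat e f g h) = solve 8 (λ a b c′ d e f g h →
    detᵖ (matᵖ a b c′ d ·ᵖ adjᵖ (matᵖ e f g h)) := detᵖ (matᵖ a b c′ d) :* detᵖ (matᵖ e f g h)) refl a b c′ d e f g h

  det-neg : ∀ X → det (neg X) ≈ det X
  det-neg (mat a b c′ d) = solve 4 (λ a b c′ d → detᵖ (negᵖ (matᵖ a b c′ d)) := detᵖ (matᵖ a b c′ d)) refl a b c′ d

  tr-neg : ∀ X → tr (neg X) ≈ - tr X
  tr-neg (mat a b c′ d) = solve 2 (λ a d → :- a :+ :- d := :- (a :+ d)) refl a d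

  unipotent-square : ∀ X → tr X ≈ 1# + 1# → det X ≈ 1# → (m22 X - 1#) * (m22 X - 1#) ≈ - (m12 X * m21 X)
  unipotent-square (mat a b c′ d) tr≈2 det≈1 = begin
    (d - 1#) * (d - 1#)                                          ≈⟨ solve 4 (λ a b c′ d →
         (d :- 1ᵖ) :* (d :- 1ᵖ) := d :* ((a :+ d) :- 2ᵖ) :+ (1ᵖ :- (a :* d :- b :* c′)) :- b :* c′) refl a b c′ d ⟩
    d * (tr (mat a b c′ d) - (1# + 1#)) + (1# - det (mat a b c′ d)) - b * c′
                                                                 ≈⟨ +-congʳ (+-cong (*-congˡ (+-congʳ tr≈2)) (+-congˡ (-‿cong det≈1))) ⟩
    d * ((1# + 1#) - (1# + 1#)) + (1# - 1#) - b * c′             ≈⟨ solve 3 (λ b c′ d →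
         d :* (2ᵖ :- 2ᵖ) :+ (1ᵖ :- 1ᵖ) :- b :* c′ := :- (b :* c′)) refl b c′ d ⟩
    - (b * c′)                                                   ∎

module UnipotentConjugacy {c ℓ} (R : CommutativeRing c ℓ) (F : IsFieldCR R) {q : ℕ} (Hq : HasOrder R q) where
  open CommutativeRing R
  open IntegerCoefficients R
  open FiniteField R F Hq
  open Matrices R
  open ProjectiveMatrices R
  open import Relation.Binary.Reasoning.Setoid setoid

  -- g below has determinant 1 and first column (α, γ); by conjugate-upper only that column matters.
  unipotent∈D : ∀ {Δ X γ} → Δ ≉ 0# → γ ≉ 0# → tr X ≈ 1# + 1# → det X ≈ 1# → m21 X ≈ - (Δ * γ * γ) → InD Δ X
  unipotent∈D {Δ} {X@(mat x₁₁ x₁₂ x₂₁ x₂₂)} {γ} Δ≉0 γ≉0 tr≈2 det≈1 x₂₁≈ =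
    (g , det-g≈1) , inj₁ (≈M-trans (conjugate-upper α (- γ ⁻¹) γ 0# Δ) (e₁₁ , e₁₂ , sym x₂₁≈ , e₂₂))
    where
    κ u α : Carrier
    κ = (Δ * γ) ⁻¹
    u = x₂₂ - 1#
    α = u * κ
    g : M₂
    g = mat α (- γ ⁻¹) γ 0#
    Δγκ≈1 : Δ * γ * κ ≈ 1#
    Δγκ≈1 = ⁻¹-inverseʳ (*-nonzero Δ≉0 γ≉0)
    det-g≈1 : det g ≈ 1#
    det-g≈1 = trans (solve 3 (λ a γ′ γ → a :* 0ᵖ :- (:- γ′) :* γ := γ :* γ′) refl α (γ ⁻¹) γ) (⁻¹-inverseʳ γ≉0)
    Δαγ≈u : Δ * α * γ ≈ u
    Δαγ≈u = begin
      Δ * α * γ          ≈⟨ solve 4 (λ Δ u κ γ → Δ :* (u :* κ) :* γ := u :* (Δ :* γ :* κ)) refl Δ u κ γ ⟩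
      u * (Δ * γ * κ)    ≈⟨ *-congˡ Δγκ≈1 ⟩
      u * 1#             ≈⟨ *-identityʳ u ⟩
      u                  ∎
    e₁₁ : det g - Δ * α * γ ≈ x₁₁
    e₁₁ = begin
      det g - Δ * α * γ                          ≈⟨ +-cong det-g≈1 (-‿cong Δαγ≈u) ⟩
      1# - u                                     ≈⟨ solve 2 (λ a d → 1ᵖ :- (d :- 1ᵖ) := a :- ((a :+ d) :- 2ᵖ)) refl x₁₁ x₂₂ ⟩
      x₁₁ - (tr X - (1# + 1#))                   ≈⟨ +-congˡ (-‿cong (+-congʳ tr≈2)) ⟩
      x₁₁ - ((1# + 1#) - (1# + 1#))              ≈⟨ solve 1 (λ a → a :- (2ᵖ :- 2ᵖ) := a) refl x₁₁ ⟩
      x₁₁                                        ∎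
    e₁₂ : Δ * α * α ≈ x₁₂
    e₁₂ = begin
      Δ * α * α                                  ≈⟨ solve 3 (λ Δ u κ → Δ :* (u :* κ) :* (u :* κ) := (u :* u) :* (Δ :* κ :* κ)) refl Δ u κ ⟩
      (u * u) * (Δ * κ * κ)                      ≈⟨ *-congʳ (unipotent-square X tr≈2 det≈1) ⟩
      - (x₁₂ * x₂₁) * (Δ * κ * κ)                ≈⟨ *-congʳ (-‿cong (*-congˡ x₂₁≈)) ⟩
      - (x₁₂ * - (Δ * γ * γ)) * (Δ * κ * κ)      ≈⟨ solve 4 (λ b Δ γ κ → :- (b :* :- (Δ :* γ :* γ)) :* (Δ :* κ :* κ)
                                                             := b :* ((Δ :* γ :* κ) :* (Δ :* γ :* κ))) refl x₁₂ Δ γ κ ⟩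
      x₁₂ * ((Δ * γ * κ) * (Δ * γ * κ))          ≈⟨ *-congˡ (*-cong Δγκ≈1 Δγκ≈1) ⟩
      x₁₂ * (1# * 1#)                            ≈⟨ solve 1 (λ b → b :* (1ᵖ :* 1ᵖ) := b) refl x₁₂ ⟩
      x₁₂                                        ∎
    e₂₂ : det g + Δ * α * γ ≈ x₂₂
    e₂₂ = trans (+-cong det-g≈1 Δαγ≈u) (solve 1 (λ d → 1ᵖ :+ (d :- 1ᵖ) := d) refl x₂₂)

lookup-injective : ∀ {a} {A : Set a} {xs : List A} → Unique xs → ∀ i j → lookupₗ xs i ≡ lookupₗ xs j → i ≡ j
lookup-injective (_ ∷ _)    Fin.zero    Fin.zero    _  = ≡.refl
lookup-injective (x∉xs ∷ _) Fin.zero    (Fin.suc j) eq = contradiction eq (All.lookup x∉xs (∈-lookup j))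
lookup-injective (x∉xs ∷ _) (Fin.suc i) Fin.zero    eq = contradiction (≡.sym eq) (All.lookup x∉xs (∈-lookup i))
lookup-injective (_ ∷ xs!)  (Fin.suc i) (Fin.suc j) eq = ≡.cong Fin.suc (lookup-injective xs! i j eq)

module TranslationOrbits {c ℓ} (R : CommutativeRing c ℓ) (F : IsFieldCR R) {q : ℕ} (Hq : HasOrder R q)
                         {p k : ℕ} (p-prime : Prime p) (q≡p^k : q ≡ p ℕ.^ k)
                         (s : CommutativeRing.Carrier R) (s≉0 : CommutativeRing._≉_ R s (CommutativeRing.0# R)) where
  open CommutativeRing R
  open HasOrder Hq
  open IntegerCoefficients R
  open FiniteField R F Hq
  open PrimeCharacteristic {k = k} p-prime q≡p^k
  open import Algebra.Properties.Semiring.Mult.TCOptimised semiring using (×-homo-+)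
  open import Algebra.Properties.Ring ring using (+-cancelˡ)
  open import Relation.Binary.Reasoning.Setoid setoid

  private instance
    p-nonZero : ℕ.NonZero p
    p-nonZero = prime⇒nonZero p-prime

  shift : ℕ → Carrier → Carrier
  shift n x = x + fromℕ n * s

  shift-cong : ∀ n {x y} → x ≈ y → shift n x ≈ shift n y
  shift-cong n = +-congʳ

  shift-shift : ∀ m n x → shift n (shift m x) ≈ shift (m ℕ.+ n) x
  shift-shift m n x = begin
    (x + fromℕ m * s) + fromℕ n * s      ≈⟨ +-assoc x _ _ ⟩
    x + (fromℕ m * s + fromℕ n * s)      ≈⟨ +-congˡ (distribʳ s (fromℕ m) (fromℕ n)) ⟨
    x + (fromℕ m + fromℕ n) * s          ≈⟨ +-congˡ (*-congʳ (×-homo-+ 1# m n)) ⟨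
    x + fromℕ (m ℕ.+ n) * s              ∎

  shift-p : ∀ x → shift p x ≈ x
  shift-p x = trans (+-congˡ (trans (*-congʳ fromℕ[p]≈0) (zeroˡ s))) (+-identityʳ x)

  shift-1 : ∀ x → shift 1 x ≈ x + s
  shift-1 x = +-congˡ (*-identityˡ s)

  residue : ℕ → Fin p
  residue n = Fin.fromℕ< (m%n<n n p)

  shift-multiple : ∀ m x → shift (m ℕ.* p) x ≈ x
  shift-multiple zero    x = trans (+-congˡ (zeroˡ s)) (+-identityʳ x)
  shift-multiple (suc m) x = begin
    shift (p ℕ.+ m ℕ.* p) x         ≈⟨ shift-shift p (m ℕ.* p) x ⟨
    shift (m ℕ.* p) (shift p x)     ≈⟨ shift-cong (m ℕ.* p) (shift-p x) ⟩
    shift (m ℕ.* p) x               ≈⟨ shift-multiple m x ⟩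
    x                               ∎

  shift-residue : ∀ n x → shift (toℕ (residue n)) x ≈ shift n x
  shift-residue n x = begin
    shift (toℕ (residue n)) x                ≡⟨ ≡.cong (λ m → shift m x) (Fin.toℕ-fromℕ< (m%n<n n p)) ⟩
    shift (n % p) x                         ≈⟨ shift-multiple (n / p) _ ⟨
    shift (n / p ℕ.* p) (shift (n % p) x)   ≈⟨ shift-shift (n % p) _ x ⟩
    shift (n % p ℕ.+ n / p ℕ.* p) x         ≡⟨ ≡.cong (λ m → shift m x) (m≡m%n+[m/n]*n n p) ⟨
    shift n x                               ∎

  shift-zero : ∀ x → shift 0 x ≈ x
  shift-zero = shift-multiple 0

  shift-suc : ∀ n x → shift (suc n) x ≈ shift n x + s
  shift-suc n x = begin
    shift (suc n) x              ≡⟨ ≡.cong (λ m → shift m x) (ℕ.+-comm 1 n) ⟩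
    shift (n ℕ.+ 1) x            ≈⟨ shift-shift n 1 x ⟨
    shift 1 (shift n x)          ≈⟨ shift-1 (shift n x) ⟩
    shift n x + s                ∎

  shift-no-fixpoint : ∀ {n} x → 0 ℕ.< n → n ℕ.< p → shift n x ≉ x
  shift-no-fixpoint {n} x 0<n n<p shift≈x =
    [ fromℕ-nonzero 0<n n<p , s≉0 ]′ (x*y≈0⇒x≈0∨y≈0 (+-cancelˡ x _ _ (trans shift≈x (sym (+-identityʳ x)))))

  private
    shift-injective-< : ∀ x {m n} → m ℕ.< n → n ℕ.< p → shift m x ≉ shift n x
    shift-injective-< x {m} {n} m<n n<p eq =
      shift-no-fixpoint (shift m x) (ℕ.m<n⇒0<n∸m m<n) (ℕ.≤-<-trans (ℕ.m∸n≤m n m) n<p) (begin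
        shift (n ℕ.∸ m) (shift m x)    ≈⟨ shift-shift m (n ℕ.∸ m) x ⟩
        shift (m ℕ.+ (n ℕ.∸ m)) x      ≡⟨ ≡.cong (λ k → shift k x) (ℕ.m+[n∸m]≡n (ℕ.<⇒≤ m<n)) ⟩
        shift n x                      ≈⟨ eq ⟨
        shift m x                      ∎)

  shift-injective : ∀ x (j j′ : Fin p) → shift (toℕ j) x ≈ shift (toℕ j′) x → j ≡ j′
  shift-injective x j j′ eq with ℕ.<-cmp (toℕ j) (toℕ j′)
  ... | tri< j<j′ _ _ = contradiction eq (shift-injective-< x j<j′ (Fin.toℕ<n j′))
  ... | tri≈ _ j≡j′ _ = Fin.toℕ-injective j≡j′
  ... | tri> _ _ j′<j = contradiction (sym eq) (shift-injective-< x j′<j (Fin.toℕ<n j))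

  negate : Fin p → Fin p
  negate j = residue (p ℕ.∸ toℕ j)

  shift-negate : ∀ j x → shift (toℕ (negate j)) (shift (toℕ j) x) ≈ x
  shift-negate j x = begin
    shift (toℕ (negate j)) (shift (toℕ j) x)     ≈⟨ shift-residue (p ℕ.∸ toℕ j) _ ⟩
    shift (p ℕ.∸ toℕ j) (shift (toℕ j) x)        ≈⟨ shift-shift (toℕ j) _ x ⟩
    shift (toℕ j ℕ.+ (p ℕ.∸ toℕ j)) x            ≡⟨ ≡.cong (λ k → shift k x) (ℕ.m+[n∸m]≡n (ℕ.<⇒≤ (Fin.toℕ<n j))) ⟩
    shift p x                                    ≈⟨ shift-p x ⟩
    x                                            ∎

  next : Fin p → Fin p
  next j = residue (suc (toℕ j))

  open Matrices R using (Succ)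

  Succ-next : ∀ j → Succ p j (next j)
  Succ-next j with ℕ.m≤n⇒m<n∨m≡n (Fin.toℕ<n j)
  ... | inj₁ 1+j<p = inj₁ (≡.trans (Fin.toℕ-fromℕ< _) (m<n⇒m%n≡m 1+j<p))
  ... | inj₂ 1+j≡p = inj₂ (≡.trans (Fin.toℕ-fromℕ< _) (≡.trans (≡.cong (_% p) 1+j≡p) (n%n≡0 p)) , 1+j≡p)

  shift-Succ : ∀ {j j′} x → Succ p j j′ → shift (toℕ j′) x ≈ shift (toℕ j) x + s
  shift-Succ {j} x (inj₁ j′≡1+j) = trans (reflexive (≡.cong (λ k → shift k x) j′≡1+j)) (shift-suc (toℕ j) x)
  shift-Succ {j} {j′} x (inj₂ (j′≡0 , 1+j≡p)) = begin
    shift (toℕ j′) x             ≡⟨ ≡.cong (λ k → shift k x) j′≡0 ⟩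
    shift 0 x                    ≈⟨ shift-zero x ⟩
    x                            ≈⟨ shift-p x ⟨
    shift p x                    ≡⟨ ≡.cong (λ k → shift k x) 1+j≡p ⟨
    shift (suc (toℕ j)) x        ≈⟨ shift-suc (toℕ j) x ⟩
    shift (toℕ j) x + s          ∎

  -- Each orbit of x ↦ x + s is represented by its element of least index.
  MinimalInOrbit : Pred (Fin q) 0ℓ
  MinimalInOrbit i = ∀ (j : Fin p) → toℕ i ℕ.≤ toℕ (index (shift (toℕ j) (enum i)))

  minimal? : Decidable MinimalInOrbit
  minimal? i = Fin.all? (λ j → toℕ i ℕ.≤? toℕ (index (shift (toℕ j) (enum i))))

  least : (f : Fin p → ℕ) → ∃ λ j₀ → ∀ j → f j₀ ℕ.≤ f j
  least f = argmin f (residue 0) (allFin p) , λ j → All.lookup (f[argmin]≤f[xs] {f = f} (residue 0) (allFin p)) (∈-allFin j)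

  orbit-minimum : ∀ x → ∃ λ i → MinimalInOrbit i × ∃ λ j → shift (toℕ j) (enum i) ≈ x
  orbit-minimum x with least (λ j → toℕ (index (shift (toℕ j) x)))
  ... | j₀ , j₀-least = index y , minimal , negate j₀ , trans (shift-cong (toℕ (negate j₀)) (enum-index y)) (shift-negate j₀ x)
    where
    y : Carrier
    y = shift (toℕ j₀) x
    minimal : MinimalInOrbit (index y)
    minimal j = ℕ.≤-trans (j₀-least (residue (toℕ j₀ ℕ.+ toℕ j))) (ℕ.≤-reflexive (≡.cong toℕ (index-cong (begin
      shift (toℕ (residue (toℕ j₀ ℕ.+ toℕ j))) x     ≈⟨ shift-residue _ x ⟩
      shift (toℕ j₀ ℕ.+ toℕ j) x                    ≈⟨ shift-shift (toℕ j₀) (toℕ j) x ⟨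
      shift (toℕ j) y                               ≈⟨ shift-cong (toℕ j) (enum-index y) ⟨
      shift (toℕ j) (enum (index y))                ∎))))

  orbit-minimum-unique : ∀ {i i′} → MinimalInOrbit i → MinimalInOrbit i′ →
                         ∀ j → enum i′ ≈ shift (toℕ j) (enum i) → i ≡ i′
  orbit-minimum-unique {i} {i′} i-min i′-min j i′≈ = Fin.toℕ-injective (ℕ.≤-antisym
    (ℕ.≤-trans (i-min j) (ℕ.≤-reflexive (≡.cong toℕ (≡.sym (index-unique i′≈)))))
    (ℕ.≤-trans (i′-min (negate j)) (ℕ.≤-reflexive (≡.cong toℕ (≡.sym (index-unique i≈))))))
    where
    i≈ : enum i ≈ shift (toℕ (negate j)) (enum i′)
    i≈ = sym (trans (shift-cong (toℕ (negate j)) i′≈) (shift-negate j (enum i)))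

  opaque
    representatives : List (Fin q)
    representatives = filter minimal? (allFin q)

    representatives-minimal : All MinimalInOrbit representatives
    representatives-minimal = all-filter minimal? (allFin q)

    minimal∈representatives : ∀ {i} → MinimalInOrbit i → i ∈ representatives
    minimal∈representatives i-min = ∈-filter⁺ minimal? (∈-allFin _) i-min

    representatives-unique : Unique representatives
    representatives-unique = Unique.filter⁺ minimal? (Unique.allFin⁺ q)

  orbits : ℕ
  orbits = length representatives

  representative : Fin orbits → Fin q
  representative = lookupₗ representatives

  representative-minimal : ∀ o → MinimalInOrbit (representative o)
  representative-minimal o = All.lookup representatives-minimal (∈-lookup o)

  vertex : Fin orbits → Fin p → Carrier
  vertex o j = shift (toℕ j) (enum (representative o))

  vertex-surjective : ∀ x → ∃ λ o → ∃ λ j → vertex o j ≈ x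
  vertex-surjective x =
    let (i , i-min , j , eq) = orbit-minimum x
        i∈reps = minimal∈representatives i-min
    in Any.index i∈reps , j , trans (shift-cong (toℕ j) (reflexive (≡.cong enum (≡.sym (lookup-index i∈reps))))) eq

  vertex-injective : ∀ {o j o′ j′} → vertex o j ≈ vertex o′ j′ → o ≡ o′ × j ≡ j′
  vertex-injective {o} {j} {o′} {j′} eq = o≡o′ , shift-injective (enum r) j j′ (trans eq (shift-cong (toℕ j′) (reflexive (≡.cong enum (≡.sym r≡r′)))))
    where
    r r′ : Fin q
    r  = representative o
    r′ = representative o′
    r′≈ : enum r′ ≈ shift (toℕ (residue (toℕ j ℕ.+ toℕ (negate j′)))) (enum r)
    r′≈ = begin
      enum r′                                          ≈⟨ shift-negate j′ (enum r′) ⟨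
      shift (toℕ (negate j′)) (vertex o′ j′)           ≈⟨ shift-cong (toℕ (negate j′)) eq ⟨
      shift (toℕ (negate j′)) (vertex o j)             ≈⟨ shift-shift (toℕ j) (toℕ (negate j′)) (enum r) ⟩
      shift (toℕ j ℕ.+ toℕ (negate j′)) (enum r)       ≈⟨ shift-residue _ (enum r) ⟨
      shift (toℕ (residue (toℕ j ℕ.+ toℕ (negate j′)))) (enum r) ∎
    r≡r′ : r ≡ r′
    r≡r′ = orbit-minimum-unique (representative-minimal o) (representative-minimal o′) (residue (toℕ j ℕ.+ toℕ (negate j′))) r′≈
    o≡o′ : o ≡ o′
    o≡o′ = lookup-injective representatives-unique o o′ r≡r′

  orbits*p≡q : orbits ℕ.* p ≡ q
  orbits*p≡q = ℕ.≤-antisym (Fin.injective⇒≤ label-injective) (Fin.injective⇒≤ position-injective)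
    where
    label : Fin (orbits ℕ.* p) → Fin q
    label z = let (o , j) = Fin.remQuot {orbits} p z in index (vertex o j)
    label-injective : ∀ {z z′} → label z ≡ label z′ → z ≡ z′
    label-injective {z} {z′} eq =
      let (o , j) = Fin.remQuot {orbits} p z ; (o′ , j′) = Fin.remQuot {orbits} p z′
          (o≡o′ , j≡j′) = vertex-injective {o} {j} {o′} {j′} (index-injective eq)
      in ≡.trans (≡.sym (Fin.combine-remQuot {orbits} p z))
                 (≡.trans (≡.cong₂ Fin.combine o≡o′ j≡j′) (Fin.combine-remQuot {orbits} p z′))
    position : Fin q → Fin (orbits ℕ.* p)
    position i = let (o , j , _) = vertex-surjective (enum i) in Fin.combine o j
    position-injective : ∀ {i i′} → position i ≡ position i′ → i ≡ i′
    position-injective {i} {i′} eq =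
      let (o  , j  , v≈i)  = vertex-surjective (enum i)
          (o′ , j′ , v≈i′) = vertex-surjective (enum i′)
          (o≡o′ , j≡j′) = Fin.combine-injective o j o′ j′ eq
      in enum-inj i i′ (trans (sym v≈i) (trans (reflexive (≡.cong₂ vertex o≡o′ j≡j′)) v≈i′))

  open Matrices R using (M₂; _≈P_; CycleUnion)
  open ProjectiveMatrices R using (≈P-trans)

  private
    vertex-step : ∀ {o j o′ j′} → vertex o′ j′ ≈ vertex o j + s → o ≡ o′ × Succ p j j′
    vertex-step {o} {j} eq with vertex-injective (trans eq (sym (shift-Succ _ (Succ-next j))))
    ... | o′≡o , j′≡next = ≡.sym o′≡o , ≡.subst (Succ p j) (≡.sym j′≡next) (Succ-next j)

  cycles : ∀ {v e} {V : M₂ → Set v} {E : M₂ → M₂ → Set e} (embed : Carrier → M₂) →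
           (∀ {x y} → x ≈ y → embed x ≈P embed y) → (∀ {x y} → embed x ≈P embed y → x ≈ y) →
           (∀ x → V (embed x)) → (∀ X → V X → ∃ λ x → embed x ≈P X) →
           (∀ x y → E (embed x) (embed y) ⇔ (y ≈ x + s ⊎ x ≈ y + s)) →
           ∀ m → m ℕ.* p ≡ q → CycleUnion V E m p
  cycles {V = V} {E} embed embed-cong embed-injective in-V onto edges m m*p≡q =
    ≡.subst (λ n → CycleUnion V E n p) (ℕ.*-cancelʳ-≡ orbits m p (≡.trans orbits*p≡q (≡.sym m*p≡q))) (record
      { vert  = λ o j → embed (vertex o j)
      ; in-V  = λ o j → in-V (vertex o j)
      ; onto  = λ X VX → let (x , x≈X) = onto X VX ; (o , j , v≈x) = vertex-surjective x in
                         o , j , ≈P-trans (embed-cong v≈x) x≈X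
      ; inj   = λ o j o′ j′ → vertex-injective ∘ embed-injective
      ; edges = λ o j o′ j′ → mk⇔ (adjacent⇒ o j o′ j′ ∘ Equivalence.to (edges _ _))
                                   (Equivalence.from (edges _ _) ∘ ⇒adjacent o j o′ j′)
      })
    where
    adjacent⇒ : ∀ o j o′ j′ → vertex o′ j′ ≈ vertex o j + s ⊎ vertex o j ≈ vertex o′ j′ + s →
                o ≡ o′ × (Succ p j j′ ⊎ Succ p j′ j)
    adjacent⇒ o j o′ j′ (inj₁ forward)  = let (o≡o′ , succ) = vertex-step forward  in o≡o′ , inj₁ succ
    adjacent⇒ o j o′ j′ (inj₂ backward) = let (o′≡o , succ) = vertex-step backward in ≡.sym o′≡o , inj₂ succ
    ⇒adjacent : ∀ o j o′ j′ → o ≡ o′ × (Succ p j j′ ⊎ Succ p j′ j) →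
                vertex o′ j′ ≈ vertex o j + s ⊎ vertex o j ≈ vertex o′ j′ + s
    ⇒adjacent o j .o j′ (≡.refl , inj₁ succ) = inj₁ (shift-Succ _ succ)
    ⇒adjacent o j .o j′ (≡.refl , inj₂ succ) = inj₂ (shift-Succ _ succ)

module Residues where
  open import Relation.Binary.PropositionalEquality using (module ≡-Reasoning)

  prime≥5⇒odd : ∀ {p} → Prime p → 5 ℕ.≤ p → p % 2 ≢ 0
  prime≥5⇒odd {p} p-prime 5≤p p%2≡0 with prime⇒irreducible p-prime (m%n≡0⇒n∣m p 2 p%2≡0)
  ... | inj₁ ()
  ... | inj₂ 2≡p = ℕ.<-irrefl 2≡p (ℕ.≤-trans (ℕ.s≤s (ℕ.s≤s (ℕ.s≤s ℕ.z≤n))) 5≤p)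

  odd⇒square%4≡1 : ∀ {n} → n % 2 ≢ 0 → (n ℕ.* n) % 4 ≡ 1
  odd⇒square%4≡1 {n} odd = ≡.trans (%-distribˡ-* n n 4) (by-residue (n % 4) ≡.refl (m%n<n n 4))
    where
    by-residue : ∀ r → n % 4 ≡ r → r ℕ.< 4 → (r ℕ.* r) % 4 ≡ 1
    by-residue 0 n%4≡0 _ = contradiction (≡.trans (≡.sym (m∣n⇒o%n%m≡o%m 2 4 n (divides 2 ≡.refl))) (≡.cong (_% 2) n%4≡0)) odd
    by-residue 1 _ _ = ≡.refl
    by-residue 2 n%4≡2 _ = contradiction (≡.trans (≡.sym (m∣n⇒o%n%m≡o%m 2 4 n (divides 2 ≡.refl))) (≡.cong (_% 2) n%4≡2)) odd
    by-residue 3 _ _ = ≡.refl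
    by-residue (suc (suc (suc (suc _)))) _ (ℕ.s≤s (ℕ.s≤s (ℕ.s≤s (ℕ.s≤s ()))))

  ^-%4≡1 : ∀ {n} → n % 4 ≡ 1 → ∀ j → (n ℕ.^ j) % 4 ≡ 1
  ^-%4≡1 n%4≡1 zero    = ≡.refl
  ^-%4≡1 {n} n%4≡1 (suc j) = begin
    (n ℕ.* n ℕ.^ j) % 4                  ≡⟨ %-distribˡ-* n (n ℕ.^ j) 4 ⟩
    ((n % 4) ℕ.* ((n ℕ.^ j) % 4)) % 4    ≡⟨ ≡.cong₂ (λ a b → (a ℕ.* b) % 4) n%4≡1 (^-%4≡1 n%4≡1 j) ⟩
    1                                    ∎
    where open ≡-Reasoning

  even-power%4≡1 : ∀ {p q k} → Prime p → 5 ℕ.≤ p → (∃ λ j → k ≡ 2 ℕ.* j) → q ≡ p ℕ.^ k → q % 4 ≡ 1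
  even-power%4≡1 {p} p-prime 5≤p (j , ≡.refl) ≡.refl = begin
    (p ℕ.^ (2 ℕ.* j)) % 4        ≡⟨ ≡.cong (_% 4) (ℕ.^-*-assoc p 2 j) ⟨
    ((p ℕ.^ 2) ℕ.^ j) % 4        ≡⟨ ≡.cong (λ n → (n ℕ.^ j) % 4) (≡.cong (p ℕ.*_) (ℕ.*-identityʳ p)) ⟩
    ((p ℕ.* p) ℕ.^ j) % 4        ≡⟨ ^-%4≡1 (odd⇒square%4≡1 {p} (prime≥5⇒odd p-prime 5≤p)) j ⟩
    1                            ∎
    where open ≡-Reasoning

module Neighbourhood {c ℓ} (R : CommutativeRing c ℓ) (F : IsFieldCR R) {q : ℕ} (Hq : HasOrder R q)
                     {p k : ℕ} (p-prime : Prime p) (5≤p : 5 ℕ.≤ p) (q≡p^k : q ≡ p ℕ.^ k)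
                     (Δ δ : CommutativeRing.Carrier R) (Δ-nonsquare : ¬ Matrices.IsSquare R Δ)
                     (Δδ≈1 : CommutativeRing._≈_ R (CommutativeRing._*_ R Δ δ) (CommutativeRing.1# R)) where
  open CommutativeRing R
  open IsFieldCR F using (0≉1)
  open IntegerCoefficients R
  open FiniteField R F Hq
  open PrimeCharacteristic {k = k} p-prime q≡p^k
  open Matrices R
  open ProjectiveMatrices R
  open UnipotentConjugacy R F Hq
  open import Algebra.Properties.Ring ring using (-‿involutive; x∙y⁻¹≈ε⇒x≈y; x≈y⇒x∙y⁻¹≈ε; +-cancelˡ)
  open import Relation.Binary.Reasoning.Setoid setoid

  two≉0 : 1# + 1# ≉ 0#
  two≉0 = fromℕ-nonzero {2} (ℕ.s≤s ℕ.z≤n) (ℕ.≤-trans (ℕ.s≤s (ℕ.s≤s (ℕ.s≤s ℕ.z≤n))) 5≤p)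

  four≉0 : four ≉ 0#
  four≉0 = fromℕ-nonzero {4} (ℕ.s≤s ℕ.z≤n) 5≤p

  Δ≉0 : Δ ≉ 0#
  Δ≉0 Δ≈0 = 0≉1 (trans (sym (trans (*-congʳ Δ≈0) (zeroˡ δ))) Δδ≈1)

  δ≉0 : δ ≉ 0#
  δ≉0 δ≈0 = 0≉1 (trans (sym (trans (*-congˡ δ≈0) (zeroʳ Δ))) Δδ≈1)

  4δ≉0 : four * δ ≉ 0#
  4δ≉0 = *-nonzero four≉0 δ≉0

  tr-C₂-adj-upper : ∀ b t → tr (C₂mat δ b · adj (upper t)) ≈ 1# + 1# - four * δ * t
  tr-C₂-adj-upper = solve 3 (λ δ b t → trᵖ (C₂ᵖ δ b ·ᵖ adjᵖ (upperᵖ t)) := 2ᵖ :- 4ᵖ :* δ :* t) refl δ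

  tr-upper-adj-C₂ : ∀ b t → tr (upper t · adj (C₂mat δ b)) ≈ 1# + 1# - four * δ * t
  tr-upper-adj-C₂ = solve 3 (λ δ b t → trᵖ (upperᵖ t ·ᵖ adjᵖ (C₂ᵖ δ b)) := 2ᵖ :- 4ᵖ :* δ :* t) refl δ

  2-4a²≉±2 : ∀ {a} → a ≉ 0# → a ≉ 1# → a ≉ - 1# → ¬ (1# + 1# - four * δ * (a * a * Δ) ≈± 1# + 1#)
  2-4a²≉±2 {a} a≉0 a≉1 a≉-1 = λ
    { (inj₁ ≈2)  → a≉0 (x*x≈0⇒x≈0 (*-cancelˡ four≉0 (trans (sym 4δt≈4a²) (trans (x-y≈x⇒y≈0 ≈2) (sym (zeroʳ four))))))
    ; (inj₂ ≈-2) → [ a≉1 , a≉-1 ]′ (x*x≈1⇒x≈±1 (*-cancelˡ four≉0 (trans (sym 4δt≈4a²) (trans (4δt≈4 ≈-2) (sym (*-identityʳ four))))))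
    }
    where
    4δt≈4a² : four * δ * (a * a * Δ) ≈ four * (a * a)
    4δt≈4a² = begin
      four * δ * (a * a * Δ)          ≈⟨ solve 4 (λ f δ a Δ → f :* δ :* (a :* a :* Δ) := f :* (a :* a) :* (Δ :* δ)) refl four δ a Δ ⟩
      four * (a * a) * (Δ * δ)        ≈⟨ *-congˡ Δδ≈1 ⟩
      four * (a * a) * 1#             ≈⟨ *-identityʳ _ ⟩
      four * (a * a)                  ∎
    4δt≈4 : ∀ {t} → 1# + 1# - t ≈ - (1# + 1#) → t ≈ four
    4δt≈4 {t} eq = begin
      t                               ≈⟨ solve 1 (λ t → t := 2ᵖ :- (2ᵖ :- t)) refl t ⟩
      1# + 1# - (1# + 1# - t)         ≈⟨ +-congˡ (-‿cong eq) ⟩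
      1# + 1# - - (1# + 1#)           ≈⟨ solve 0 (2ᵖ :- :- 2ᵖ := 4ᵖ) refl ⟩
      four                            ∎

  C₁-C₂-apart : ∀ X Y → InC₁ Δ X → InC₂ δ Y → ¬ (X ≈P Y) × ¬ Adj Δ X Y × ¬ Adj Δ Y X
  C₁-C₂-apart X Y (a , a≉0 , a≉1 , a≉-1 , _ , U≈X) (b , C≈Y) = X≉Y , ¬Adj-XY , ¬Adj-YX
    where
    t = a * a * Δ
    X≉Y : ¬ (X ≈P Y)
    X≉Y X≈Y = 4δ≉0 (±0 (≈±-trans (m21-≈P C≈Y) (≈±-trans (m21-≈P (≈P-sym X≈Y)) (m21-≈P (≈P-sym U≈X)))))
    ¬Adj-XY : ¬ Adj Δ X Y
    ¬Adj-XY (_ , Y·X⁻¹∈D) = 2-4a²≉±2 a≉0 a≉1 a≉-1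
      (≈±-trans (inj₁ (sym (tr-C₂-adj-upper b t))) (≈±-trans (tr-·adj-≈P C≈Y U≈X) (InD⇒tr≈±2 Y·X⁻¹∈D)))
    ¬Adj-YX : ¬ Adj Δ Y X
    ¬Adj-YX (_ , X·Y⁻¹∈D) = 2-4a²≉±2 a≉0 a≉1 a≉-1
      (≈±-trans (inj₁ (sym (tr-upper-adj-C₂ b t))) (≈±-trans (tr-·adj-≈P U≈X C≈Y) (InD⇒tr≈±2 X·Y⁻¹∈D)))

  C₂-cong : ∀ {b c} → b ≈ c → C₂mat δ b ≈P C₂mat δ c
  C₂-cong b≈c = inj₁ ( +-congˡ (*-congʳ (*-congˡ b≈c)) , -‿cong (*-congʳ (*-cong (*-congˡ b≈c) b≈c))
                     , refl , +-congˡ (-‿cong (*-congʳ (*-congˡ b≈c))))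

  C₂-injective : ∀ {b c} → C₂mat δ b ≈P C₂mat δ c → b ≈ c
  C₂-injective {b} {c} (inj₁ (e₁₁ , _)) = *-cancelˡ 4δ≉0 (begin
    four * δ * b    ≈⟨ solve 3 (λ f δ b → f :* δ :* b := f :* b :* δ) refl four δ b ⟩
    four * b * δ    ≈⟨ +-cancelˡ 1# _ _ e₁₁ ⟩
    four * c * δ    ≈⟨ solve 3 (λ f δ c → f :* c :* δ := f :* δ :* c) refl four δ c ⟩
    four * δ * c    ∎)
  C₂-injective (inj₂ (_ , _ , e₂₁ , _)) = contradiction
    (trans (solve 1 (λ x → 2ᵖ :* x := x :- :- x) refl (four * δ)) (x≈y⇒x∙y⁻¹≈ε e₂₁)) (*-nonzero two≉0 4δ≉0)

  det-C₂ : ∀ b → det (C₂mat δ b) ≈ 1#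
  det-C₂ = solve 2 (λ δ b → detᵖ (C₂ᵖ δ b) := 1ᵖ) refl δ

  tr-C₂-adj-C₂ : ∀ b c → tr (C₂mat δ c · adj (C₂mat δ b)) ≈ 1# + 1# + four * δ * (four * δ) * ((c - b) * (c - b))
  tr-C₂-adj-C₂ = solve 3 (λ δ b c → trᵖ (C₂ᵖ δ c ·ᵖ adjᵖ (C₂ᵖ δ b)) := 2ᵖ :+ 4ᵖ :* δ :* (4ᵖ :* δ) :* ((c :- b) :* (c :- b))) refl δ

  m21-C₂-adj-C₂ : ∀ b c → m21 (C₂mat δ c · adj (C₂mat δ b)) ≈ four * δ * (four * δ) * (c - b)
  m21-C₂-adj-C₂ = solve 3 (λ δ b c → M₂ᵖ.m21ᵖ (C₂ᵖ δ c ·ᵖ adjᵖ (C₂ᵖ δ b)) := 4ᵖ :* δ :* (4ᵖ :* δ) :* (c :- b)) refl δ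

  half : Carrier
  half = (1# + 1#) ⁻¹

  2*half≈1 : (1# + 1#) * half ≈ 1#
  2*half≈1 = ⁻¹-inverseʳ two≉0

  -- With e² = -1, e·Δ/2 is the difference c - b of the parameters of adjacent vertices of 𝒞₂.
  [4δ]²[eΔ/2]²≈-4 : ∀ e → e * e ≈ - 1# → four * δ * (four * δ) * ((e * Δ * half) * (e * Δ * half)) ≈ - four
  [4δ]²[eΔ/2]²≈-4 e e²≈-1 = begin
    four * δ * (four * δ) * ((e * Δ * half) * (e * Δ * half))
        ≈⟨ solve 4 (λ e Δ δ h → 4ᵖ :* δ :* (4ᵖ :* δ) :* ((e :* Δ :* h) :* (e :* Δ :* h))
                              := (e :* e) :* ((Δ :* δ) :* (Δ :* δ)) :* ((2ᵖ :* h) :* (2ᵖ :* h)) :* 4ᵖ) refl e Δ δ half ⟩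
    (e * e) * ((Δ * δ) * (Δ * δ)) * (((1# + 1#) * half) * ((1# + 1#) * half)) * four
        ≈⟨ *-congʳ (*-cong (*-cong e²≈-1 (*-cong Δδ≈1 Δδ≈1)) (*-cong 2*half≈1 2*half≈1)) ⟩
    - 1# * (1# * 1#) * (1# * 1#) * four
        ≈⟨ solve 1 (λ f → :- 1ᵖ :* (1ᵖ :* 1ᵖ) :* (1ᵖ :* 1ᵖ) :* f := :- f) refl four ⟩
    - four                                                          ∎

  adjacent-C₂ : ∀ b c e → e * e ≈ - 1# → c - b ≈ e * Δ * half → Adj Δ (C₂mat δ b) (C₂mat δ c)
  adjacent-C₂ b c e e²≈-1 c-b≈ = distinct , InD-resp-≈P (unipotent∈D Δ≉0 γ≉0 tr-X≈2 det-X≈1 m21-X≈) (inj₂ ≈M-refl)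
    where
    P X : M₂
    P = C₂mat δ c · adj (C₂mat δ b)
    X = neg P
    γ : Carrier
    γ = (1# + 1#) * δ * (1# + e)
    distinct : ¬ (C₂mat δ b ≈P C₂mat δ c)
    distinct C₂b≈C₂c = *-nonzero (*-nonzero (square≈-1⇒nonzero e²≈-1) Δ≉0) (⁻¹-nonzero two≉0)
      (trans (sym c-b≈) (x≈y⇒x∙y⁻¹≈ε (sym (C₂-injective C₂b≈C₂c))))
    1+e≉0 : 1# + e ≉ 0#
    1+e≉0 1+e≈0 = two≉0 (begin
      1# + 1#       ≈⟨ +-congˡ (begin
                         1#            ≈⟨ solve 0 (:- 1ᵖ :* :- 1ᵖ := 1ᵖ) refl ⟨
                         - 1# * - 1#   ≈⟨ *-cong e≈-1 e≈-1 ⟨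
                         e * e         ≈⟨ e²≈-1 ⟩
                         - 1#          ∎) ⟩
      1# + - 1#     ≈⟨ -‿inverseʳ 1# ⟩
      0#            ∎)
      where
      e≈-1 : e ≈ - 1#
      e≈-1 = trans (solve 1 (λ e → e := (1ᵖ :+ e) :- 1ᵖ) refl e) (trans (+-congʳ 1+e≈0) (+-identityˡ _))
    γ≉0 : γ ≉ 0#
    γ≉0 = *-nonzero (*-nonzero two≉0 δ≉0) 1+e≉0
    d²-term : four * δ * (four * δ) * ((c - b) * (c - b)) ≈ - four
    d²-term = trans (*-congˡ (*-cong c-b≈ c-b≈)) ([4δ]²[eΔ/2]²≈-4 e e²≈-1)
    tr-X≈2 : tr X ≈ 1# + 1#
    tr-X≈2 = begin
      tr X                               ≈⟨ tr-neg P ⟩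
      - tr P                             ≈⟨ -‿cong (trans (tr-C₂-adj-C₂ b c) (+-congˡ d²-term)) ⟩
      - (1# + 1# + - four)               ≈⟨ solve 0 (:- (2ᵖ :+ :- 4ᵖ) := 2ᵖ) refl ⟩
      1# + 1#                            ∎
    det-X≈1 : det X ≈ 1#
    det-X≈1 = trans (det-neg P) (trans (det-·adj (C₂mat δ c) (C₂mat δ b)) (trans (*-cong (det-C₂ c) (det-C₂ b)) (*-identityˡ 1#)))
    m21-P≈8eδ : four * δ * (four * δ) * (e * Δ * half) ≈ four * (1# + 1#) * e * δ
    m21-P≈8eδ = begin
      four * δ * (four * δ) * (e * Δ * half)
          ≈⟨ solve 4 (λ e Δ δ h → 4ᵖ :* δ :* (4ᵖ :* δ) :* (e :* Δ :* h) := (Δ :* δ) :* (2ᵖ :* h) :* (4ᵖ :* 2ᵖ :* e :* δ)) refl e Δ δ half ⟩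
      (Δ * δ) * ((1# + 1#) * half) * (four * (1# + 1#) * e * δ)
          ≈⟨ *-congʳ (*-cong Δδ≈1 2*half≈1) ⟩
      1# * 1# * (four * (1# + 1#) * e * δ)
          ≈⟨ solve 2 (λ e δ → 1ᵖ :* 1ᵖ :* (4ᵖ :* 2ᵖ :* e :* δ) := 4ᵖ :* 2ᵖ :* e :* δ) refl e δ ⟩
      four * (1# + 1#) * e * δ   ∎
    Δγ²≈8eδ : Δ * γ * γ ≈ four * (1# + 1#) * e * δ
    Δγ²≈8eδ = begin
      Δ * γ * γ
          ≈⟨ solve 3 (λ e Δ δ → Δ :* (2ᵖ :* δ :* (1ᵖ :+ e)) :* (2ᵖ :* δ :* (1ᵖ :+ e))
                             := (Δ :* δ) :* (4ᵖ :* δ :* (2ᵖ :* e :+ (1ᵖ :+ e :* e)))) refl e Δ δ ⟩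
      (Δ * δ) * (four * δ * ((1# + 1#) * e + (1# + e * e)))
          ≈⟨ *-cong Δδ≈1 (*-congˡ (+-congˡ (+-congˡ e²≈-1))) ⟩
      1# * (four * δ * ((1# + 1#) * e + (1# + - 1#)))
          ≈⟨ solve 2 (λ e δ → 1ᵖ :* (4ᵖ :* δ :* (2ᵖ :* e :+ (1ᵖ :+ :- 1ᵖ))) := 4ᵖ :* 2ᵖ :* e :* δ) refl e δ ⟩
      four * (1# + 1#) * e * δ   ∎
    m21-X≈ : m21 X ≈ - (Δ * γ * γ)
    m21-X≈ = -‿cong (begin
      m21 P                                         ≈⟨ m21-C₂-adj-C₂ b c ⟩
      four * δ * (four * δ) * (c - b)               ≈⟨ *-congˡ c-b≈ ⟩
      four * δ * (four * δ) * (e * Δ * half)        ≈⟨ trans m21-P≈8eδ (sym Δγ²≈8eδ) ⟩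
      Δ * γ * γ                                     ∎)

  module _ (i : Carrier) (i²≈-1 : i * i ≈ - 1#) where

    step : Carrier
    step = i * Δ * half

    step≉0 : step ≉ 0#
    step≉0 = *-nonzero (*-nonzero (square≈-1⇒nonzero i²≈-1) Δ≉0) (⁻¹-nonzero two≉0)

    adjacent⇒step : ∀ b c → Adj Δ (C₂mat δ b) (C₂mat δ c) → c ≈ b + step ⊎ b ≈ c + step
    adjacent⇒step b c (distinct , P∈D) = by-trace (≈±-trans (inj₁ (sym (tr-C₂-adj-C₂ b c))) (InD⇒tr≈±2 P∈D))
      where
      d = c - b
      K = four * δ * (four * δ)
      K≉0 : K ≉ 0#
      K≉0 = *-nonzero 4δ≉0 4δ≉0
      by-trace : 1# + 1# + K * (d * d) ≈± 1# + 1# → c ≈ b + step ⊎ b ≈ c + step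
      by-trace (inj₁ 2+Kd²≈2) = contradiction (C₂-cong (sym c≈b)) distinct
        where
        d≈0 : d ≈ 0#
        d≈0 = x*x≈0⇒x≈0 (x≉0∧x*y≈0⇒y≈0 K≉0 (x+y≈x⇒y≈0 2+Kd²≈2))
        c≈b : c ≈ b
        c≈b = x∙y⁻¹≈ε⇒x≈y c b d≈0
      by-trace (inj₂ 2+Kd²≈-2) = [ inj₁ ∘ forward , inj₂ ∘ backward ]′ (x*y≈0⇒x≈0∨y≈0 [d-s][d+s]≈0)
        where
        Kd²≈Ks² : K * (d * d) ≈ K * (step * step)
        Kd²≈Ks² = begin
          K * (d * d)                          ≈⟨ solve 2 (λ t z → z := t :+ z :- t) refl (1# + 1#) (K * (d * d)) ⟩
          1# + 1# + K * (d * d) - (1# + 1#)    ≈⟨ +-congʳ 2+Kd²≈-2 ⟩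
          - (1# + 1#) - (1# + 1#)              ≈⟨ solve 0 (:- 2ᵖ :- 2ᵖ := :- 4ᵖ) refl ⟩
          - four                               ≈⟨ [4δ]²[eΔ/2]²≈-4 i i²≈-1 ⟨
          K * (step * step)                    ∎
        [d-s][d+s]≈0 : (d - step) * (d + step) ≈ 0#
        [d-s][d+s]≈0 = trans (solve 2 (λ d s → (d :- s) :* (d :+ s) := d :* d :- s :* s) refl d step)
                             (x≈y⇒x∙y⁻¹≈ε (*-cancelˡ K≉0 Kd²≈Ks²))
        forward : d - step ≈ 0# → c ≈ b + step
        forward d-s≈0 = trans (solve 2 (λ b c → c := b :+ (c :- b)) refl b c) (+-congˡ (x∙y⁻¹≈ε⇒x≈y d step d-s≈0))
        backward : d + step ≈ 0# → b ≈ c + step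
        backward d+s≈0 = begin
          b                             ≈⟨ solve 3 (λ b c s → b := c :+ s :- ((c :- b) :+ s)) refl b c step ⟩
          c + step - (d + step)         ≈⟨ +-congˡ (-‿cong d+s≈0) ⟩
          c + step - 0#                 ≈⟨ solve 1 (λ x → x :- 0ᵖ := x) refl (c + step) ⟩
          c + step                      ∎

    step⇒adjacent : ∀ b c → c ≈ b + step ⊎ b ≈ c + step → Adj Δ (C₂mat δ b) (C₂mat δ c)
    step⇒adjacent b c (inj₁ c≈b+s) = adjacent-C₂ b c i i²≈-1
      (trans (+-congʳ c≈b+s) (solve 2 (λ b s → b :+ s :- b := s) refl b step))
    step⇒adjacent b c (inj₂ b≈c+s) = adjacent-C₂ b c (- i)
      (trans (solve 1 (λ i → :- i :* :- i := i :* i) refl i) i²≈-1)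
      (trans (+-congˡ (-‿cong b≈c+s)) (solve 4 (λ c i Δ h → c :- (c :+ i :* Δ :* h) := :- i :* Δ :* h) refl c i Δ half))

    C₂-cycles : ∀ m → m ℕ.* p ≡ q → CycleUnion (InC₂ δ) (Adj Δ) m p
    C₂-cycles = TranslationOrbits.cycles R F Hq {k = k} p-prime q≡p^k step step≉0 (C₂mat δ) C₂-cong C₂-injective
                  (λ b → b , ≈P-refl) (λ _ C → C) (λ b c → mk⇔ (adjacent⇒step b c) (step⇒adjacent b c))

open import Data.Nat using (_≤_; _^_; _*_)

lemma3p9 : ∀ {c ℓ} (R : CommutativeRing c ℓ) → IsFieldCR R →
    (p k q : ℕ) → Prime p → 5 ≤ p → (∃ λ j → k ≡ 2 * j) → q ≡ p ^ k → HasOrder R q →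
    let open CommutativeRing R renaming (_*_ to _·ᶠ_)
        open Matrices R
    in (Δ δ : Carrier) → ¬ IsSquare Δ → Δ ·ᶠ δ ≈ 1# →
       ((∀ X Y → InC₁ Δ X → InC₂ δ Y → ¬ (X ≈P Y) × ¬ Adj Δ X Y × ¬ Adj Δ Y X)
       × ((q % 4 ≡ 1) → ∀ m → m * p ≡ q → CycleUnion (InC₂ δ) (Adj Δ) m p)
       × ((q % 4 ≡ 3) → ∀ X Y → InC₂ δ X → InC₂ δ Y → ¬ Adj Δ X Y))
lemma3p9 R F p k q p-prime 5≤p k-even q≡p^k Hq Δ δ Δ-nonsquare Δδ≈1 =
    C₁-C₂-apart
  , (λ q%4≡1 → let (i , i²≈-1) = √-1 Δ Δ-nonsquare two≉0 q%4≡1 in C₂-cycles i i²≈-1)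
  , (λ q%4≡3 → contradiction (≡.trans (≡.sym q%4≡3) (even-power%4≡1 p-prime 5≤p k-even q≡p^k)) λ ())
  where
  open Neighbourhood R F Hq {k = k} p-prime 5≤p q≡p^k Δ δ Δ-nonsquare Δδ≈1
  open FiniteField R F Hq using (√-1)
  open Residues using (even-power%4≡1)
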